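{- Let $p$ be an odd integer with $p\geq 3$. Every oriented graph of order $n \geq p+2$ can be transformed, by a sequence of $(=p)$-inversions, into an oriented graph whose feedback-arc-set number is at most $\frac{1}{2}\lceil n/2\rceil$.
   Context: For an oriented graph $D$ and $X\subseteq V(D)$, the inversion of $X$ reverses the orientation of every arc with both endpoints in $X$. A $(=p)$-inversion is the inversion of a set of exactly $p$ vertices. The feedback-arc-set number $\mathrm{fas}(D)$ is the minimum size of a set of arcs whose deletion makes $D$ acyclic. -}

module Defs where

open import Data.Nat using (ℕ; suc; _≤_; _*_; ⌈_/2⌉)
open import Data.Bool using (Bool; true; false; _∧_; if_then_else_)
open import Data.Fin using (Fin)
open import Data.Fin.Subset using (Subset; ∣_∣)
open import Data.Vec using (lookup)
open import Data.List using (List; []; _∷_; length; foldl)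
open import Data.List.Relation.Unary.All using (All)
open import Data.List.Relation.Unary.Unique.Propositional using (Unique)
open import Data.List.Membership.Propositional using (_∈_)
open import Data.Product using (_×_; _,_; Σ; ∃)
open import Relation.Binary.PropositionalEquality using (_≡_)
open import Relation.Nullary using (¬_)

-- A digraph on vertex set Fin n, given by its (decidable) arc relation:
-- arc u v ≡ true  means there is an arc u → v.
Digraph : ℕ → Set
Digraph n = Fin n → Fin n → Bool

IsOriented : ∀ {n} → Digraph n → Set
IsOriented {n} D =
  ((u : Fin n) → D u u ≡ false) ×
  ((u v : Fin n) → D u v ≡ true → D v u ≡ false)

invert : ∀ {n} → Digraph n → Subset n → Digraph n
invert D X u v = if lookup X u ∧ lookup X v then D v u else D u v

invertAll : ∀ {n} → Digraph n → List (Subset n) → Digraph n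
invertAll = foldl invert

HasSize : ∀ {n} → ℕ → Subset n → Set
HasSize p X = ∣ X ∣ ≡ p

data Walk {n} (R : Fin n → Fin n → Set) : Fin n → Fin n → Set where
  step : ∀ {u v} → R u v → Walk R u v
  _∷w_ : ∀ {u v w} → R u v → Walk R v w → Walk R u w

-- Acyclic: no directed closed walk (equivalently, no directed cycle).
Acyclic : ∀ {n} → (Fin n → Fin n → Set) → Set
Acyclic {n} R = (u : Fin n) → ¬ Walk R u u

Arc : ∀ {n} → Digraph n → Fin n → Fin n → Set
Arc D u v = D u v ≡ true

deleteArcs : ∀ {n} → Digraph n → List (Fin n × Fin n) → Fin n → Fin n → Set
deleteArcs D F u v = Arc D u v × ¬ ((u , v) ∈ F)

IsFAS : ∀ {n} → Digraph n → List (Fin n × Fin n) → Set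
IsFAS D F = Unique F × All (λ e → Arc D (Data.Product.proj₁ e) (Data.Product.proj₂ e)) F
            × Acyclic (deleteArcs D F)

-- fas(D) ≤ k/2, i.e. there is a feedback arc set F with 2·|F| ≤ k
-- (fas is the minimum size of a feedback arc set and is an integer).
FasAtMostHalfOf : ∀ {n} → Digraph n → ℕ → Set
FasAtMostHalfOf D k = Σ _ λ F → IsFAS D F × 2 * length F ≤ k

module Submission where

-- Over GF(2), a sequence of inversions reverses exactly the pairs covered by an odd number of the
-- inverted sets. With p = q + 2 and a set T of q vertices avoiding a, b, c, d, inverting
-- T ∪ {a,b}, T ∪ {b,c}, T ∪ {c,d}, T ∪ {d,a} reverses just the square abcd, and every graph with
-- even degrees and an even number of edges is a sum of squares, hence reachable when n ≥ q + 4.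
-- Complete D to a tournament and compare it with the transitive tournament 0 < 1 < … < n−1; the
-- pairs on which they disagree have an even number of odd vertices. Taking the vertices in pairs
-- {2i, 2i+1}, swapping some of these consecutive pairs (the order stays acyclic) and matching the
-- remaining odd vertices, at most one per pair, by a set L of at most ½⌈n/2⌉ pairs makes every
-- degree even; the parity of the number of edges is fixed by one 3-set inversion when p = 3 and by
-- a different choice of swaps and matching otherwise. Inverting D onto the corrected tournament leaves a digraph
-- whose only cycles use arcs on L.

open import Defs
open import Data.Nat using (ℕ; zero; suc; _+_; _*_; _≤_; _<_; z≤n; s≤s; _%_; ⌈_/2⌉)
import Data.Nat.Properties as ℕ
open import Data.Bool using (Bool; true; false; not; _∧_; _∨_; _xor_; if_then_else_)
import Data.Bool as Bool
open import Data.Bool.Properties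
  using (xor-assoc; xor-comm; xor-same; xor-identityʳ; ∧-comm; ∧-identityʳ; ∧-zeroʳ; ∧-conicalˡ; ∧-conicalʳ; ∨-zeroʳ; ∧-distribˡ-∨;
         ∧-distribˡ-xor; ∧-distribʳ-xor; not-involutive; not-distribˡ-xor; xor-annihilates-not)
open import Data.Fin using (Fin; zero; suc)
import Data.Fin.Properties as Fin
open import Data.Fin.Subset using (Subset; ∣_∣)
open import Data.Vec using (Vec; []; _∷_; lookup; tabulate)
open import Data.Vec.Properties using (lookup∘tabulate)
open import Data.List using (List; []; _∷_; _++_; map; length; filter; deduplicate)
open import Data.List.Properties using (length-++; length-map; length-filter; length-deduplicate)
open import Data.List.Membership.Propositional using (_∈_)
open import Data.List.Membership.Propositional.Properties using (∈-map⁺; ∈-filter⁺; ∈-filter⁻; ∈-deduplicate⁺; ∈-deduplicate⁻)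
open import Data.List.Relation.Unary.Any using (here; there)
import Data.List.Relation.Unary.Unique.DecPropositional.Properties as UniqueDec
open import Data.List.Relation.Unary.Unique.Propositional using (Unique)
open import Data.List.Relation.Unary.AllPairs using ([]; _∷_)
open import Data.List.Relation.Unary.All using (All; []; _∷_)
import Data.List.Relation.Unary.All as All
open import Data.List.Relation.Unary.All.Properties using (++⁺; map⁺)
open import Data.Product using (Σ; _×_; _,_; proj₁; proj₂)
import Data.Product.Properties as ×
open import Data.Sum using (_⊎_; inj₁; inj₂)
import Data.Sum as Sum
open import Function using (_∘_)
open import Relation.Binary.PropositionalEquality using (_≡_; _≢_; refl; sym; trans; cong; cong₂; subst; module ≡-Reasoning)
open import Relation.Binary.Definitions using (DecidableEquality)
open import Relation.Nullary using (Dec; yes; no)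
open import Data.Empty using (⊥-elim)

allAssignments : ∀ k → (Vec Bool k → Bool) → Bool
allAssignments zero f = f []
allAssignments (suc k) f = allAssignments k (f ∘ (true ∷_)) ∧ allAssignments k (f ∘ (false ∷_))

allAssignments-sound : ∀ k f → allAssignments k f ≡ true → ∀ v → f v ≡ true
allAssignments-sound zero f h [] = h
allAssignments-sound (suc k) f h (true ∷ v) = allAssignments-sound k _ (∧-conicalˡ _ _ h) v
allAssignments-sound (suc k) f h (false ∷ v) = allAssignments-sound k _ (∧-conicalʳ _ _ h) v

byTruthTable : ∀ k (f g : Vec Bool k → Bool) →
  allAssignments k (λ v → not (f v xor g v)) ≡ true → ∀ v → f v ≡ g v
byTruthTable k f g h v = agree (f v) (g v) (allAssignments-sound k _ h v)
  where
  agree : ∀ x y → not (x xor y) ≡ true → x ≡ y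
  agree true true _ = refl
  agree false false _ = refl

xor-interchange : ∀ a b c d → (a xor b) xor (c xor d) ≡ (a xor c) xor (b xor d)
xor-interchange a b c d = byTruthTable 4
  (λ { (a ∷ b ∷ c ∷ d ∷ []) → (a xor b) xor (c xor d) })
  (λ { (a ∷ b ∷ c ∷ d ∷ []) → (a xor c) xor (b xor d) }) refl (a ∷ b ∷ c ∷ d ∷ [])

xor≡false⇒≡ : ∀ {a b} → a xor b ≡ false → a ≡ b
xor≡false⇒≡ {true} {true} _ = refl
xor≡false⇒≡ {false} {false} _ = refl

xor₃≡false⇒≡ : ∀ {a b c} → (a xor b) xor c ≡ false → a ≡ b xor c
xor₃≡false⇒≡ {a} {b} {c} h = xor≡false⇒≡ (trans (sym (xor-assoc a b c)) h)

∧-false : ∀ c {x} → (c ≡ true → x ≡ false) → c ∧ x ≡ false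
∧-false true h = h refl
∧-false false h = refl

disjoint-∨⇒xor : ∀ t u v → t ∧ u ≡ false → t ∧ v ≡ false → u ∧ v ≡ false → t ∨ (u ∨ v) ≡ t xor (u xor v)
disjoint-∨⇒xor true false false _ _ _ = refl
disjoint-∨⇒xor false true false _ _ _ = refl
disjoint-∨⇒xor false false v _ _ _ = refl
disjoint-∨⇒xor true true v () _ _
disjoint-∨⇒xor true false true _ () _
disjoint-∨⇒xor false true true _ _ ()

xor-flip-middle : ∀ a b c → a xor ((b xor true) xor c) ≡ not (a xor (b xor c))
xor-flip-middle a b c = byTruthTable 3
  (λ { (a ∷ b ∷ c ∷ []) → a xor ((b xor true) xor c) }) (λ { (a ∷ b ∷ c ∷ []) → not (a xor (b xor c)) })
  refl (a ∷ b ∷ c ∷ [])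

xor-cancelʳ : ∀ a b c → a ≡ c xor b → a xor b ≡ c
xor-cancelʳ a b c h = begin
  a xor b           ≡⟨ cong (_xor b) h ⟩
  (c xor b) xor b   ≡⟨ xor-assoc c b b ⟩
  c xor (b xor b)   ≡⟨ cong (c xor_) (xor-same b) ⟩
  c xor false       ≡⟨ xor-identityʳ c ⟩
  c ∎
  where open ≡-Reasoning

_≡ᵇ_ : ∀ {n} → Fin n → Fin n → Bool
zero ≡ᵇ zero = true
zero ≡ᵇ suc _ = false
suc _ ≡ᵇ zero = false
suc x ≡ᵇ suc y = x ≡ᵇ y

≡ᵇ-refl : ∀ {n} (x : Fin n) → (x ≡ᵇ x) ≡ true
≡ᵇ-refl zero = refl
≡ᵇ-refl (suc x) = ≡ᵇ-refl x

≡ᵇ⇒≡ : ∀ {n} {x y : Fin n} → (x ≡ᵇ y) ≡ true → x ≡ y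
≡ᵇ⇒≡ {x = zero} {zero} _ = refl
≡ᵇ⇒≡ {x = suc x} {suc y} h = cong suc (≡ᵇ⇒≡ h)

≡ᵇ-sym : ∀ {n} (x y : Fin n) → (x ≡ᵇ y) ≡ (y ≡ᵇ x)
≡ᵇ-sym zero zero = refl
≡ᵇ-sym zero (suc y) = refl
≡ᵇ-sym (suc x) zero = refl
≡ᵇ-sym (suc x) (suc y) = ≡ᵇ-sym x y

≢⇒≡ᵇ-false : ∀ {n} {x y : Fin n} → x ≢ y → (x ≡ᵇ y) ≡ false
≢⇒≡ᵇ-false {x = x} {y} x≢y with x ≡ᵇ y in eq
... | true = ⊥-elim (x≢y (≡ᵇ⇒≡ eq))
... | false = refl

≢⇒disjoint : ∀ {n} {x y : Fin n} → x ≢ y → ∀ w → (w ≡ᵇ x) ∧ (w ≡ᵇ y) ≡ false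
≢⇒disjoint {x = x} {y} x≢y w with w ≡ᵇ x in e
... | false = refl
... | true = subst (λ z → (z ≡ᵇ y) ≡ false) (sym (≡ᵇ⇒≡ {x = w} e)) (≢⇒≡ᵇ-false x≢y)

_<ᵇ_ : ∀ {n} → Fin n → Fin n → Bool
zero <ᵇ zero = false
zero <ᵇ suc _ = true
suc _ <ᵇ zero = false
suc x <ᵇ suc y = x <ᵇ y

<ᵇ-irrefl : ∀ {n} (x : Fin n) → (x <ᵇ x) ≡ false
<ᵇ-irrefl zero = refl
<ᵇ-irrefl (suc x) = <ᵇ-irrefl x

<ᵇ-trichotomy : ∀ {n} (x y : Fin n) → (x <ᵇ y) xor (y <ᵇ x) ≡ not (x ≡ᵇ y)
<ᵇ-trichotomy zero zero = refl
<ᵇ-trichotomy zero (suc y) = refl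
<ᵇ-trichotomy (suc x) zero = refl
<ᵇ-trichotomy (suc x) (suc y) = <ᵇ-trichotomy x y

<ᵇ-asym : ∀ {n} (x y : Fin n) → x ≢ y → (y <ᵇ x) ≡ not (x <ᵇ y)
<ᵇ-asym x y x≢y = solve (trans (<ᵇ-trichotomy x y) (cong not (≢⇒≡ᵇ-false x≢y)))
  where
  solve : ∀ {a b} → a xor b ≡ true → b ≡ not a
  solve {true} {false} _ = refl
  solve {false} {true} _ = refl

<ᵇ⇒≢ : ∀ {n} {x y : Fin n} → (x <ᵇ y) ≡ true → x ≢ y
<ᵇ⇒≢ {x = x} h refl with trans (sym h) (<ᵇ-irrefl x)
... | ()

shift₂ : ∀ {n} → Fin n → Fin (suc (suc n))
shift₂ i = suc (suc i)

shift₂-injective : ∀ {n} {i j : Fin n} → shift₂ i ≡ shift₂ j → i ≡ j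
shift₂-injective refl = refl

⊕Σ : ∀ {n} → (Fin n → Bool) → Bool
⊕Σ {zero} f = false
⊕Σ {suc n} f = f zero xor ⊕Σ (f ∘ suc)

⊕Σ-cong : ∀ {n} {f g : Fin n → Bool} → (∀ i → f i ≡ g i) → ⊕Σ f ≡ ⊕Σ g
⊕Σ-cong {zero} h = refl
⊕Σ-cong {suc n} h = cong₂ _xor_ (h zero) (⊕Σ-cong (h ∘ suc))

⊕Σ-false : ∀ {n} {f : Fin n → Bool} → (∀ i → f i ≡ false) → ⊕Σ f ≡ false
⊕Σ-false {zero} h = refl
⊕Σ-false {suc n} h rewrite h zero = ⊕Σ-false (h ∘ suc)

⊕Σ-xor : ∀ {n} (f g : Fin n → Bool) → ⊕Σ (λ i → f i xor g i) ≡ ⊕Σ f xor ⊕Σ g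
⊕Σ-xor {zero} f g = refl
⊕Σ-xor {suc n} f g rewrite ⊕Σ-xor (f ∘ suc) (g ∘ suc) = xor-interchange (f zero) (g zero) _ _

⊕Σ-∧ˡ : ∀ {n} c (f : Fin n → Bool) → ⊕Σ (λ i → c ∧ f i) ≡ c ∧ ⊕Σ f
⊕Σ-∧ˡ true f = refl
⊕Σ-∧ˡ {n} false f = ⊕Σ-false {n} (λ _ → refl)

⊕Σ-swap : ∀ {m n} (f : Fin m → Fin n → Bool) → ⊕Σ (λ i → ⊕Σ (f i)) ≡ ⊕Σ (λ j → ⊕Σ (λ i → f i j))
⊕Σ-swap {zero} {n} f = sym (⊕Σ-false {n} (λ _ → refl))
⊕Σ-swap {suc m} f = trans (cong (⊕Σ (f zero) xor_) (⊕Σ-swap (f ∘ suc)))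
                          (sym (⊕Σ-xor (f zero) (λ j → ⊕Σ (λ i → f (suc i) j))))

⊕Σ-select : ∀ {n} (a : Fin n) (g : Fin n → Bool) → ⊕Σ (λ i → (i ≡ᵇ a) ∧ g i) ≡ g a
⊕Σ-select {suc n} zero g = trans (cong (g zero xor_) (⊕Σ-false {n} (λ _ → refl))) (xor-identityʳ _)
⊕Σ-select {suc n} (suc a) g = ⊕Σ-select a (g ∘ suc)

⊕Σ-selectʳ : ∀ {n} (a : Fin n) (g : Fin n → Bool) → ⊕Σ (λ i → g i ∧ (i ≡ᵇ a)) ≡ g a
⊕Σ-selectʳ a g = trans (⊕Σ-cong (λ i → ∧-comm (g i) _)) (⊕Σ-select a g)

⊕Σ-≡ᵇ : ∀ {n} (a : Fin n) → ⊕Σ (_≡ᵇ a) ≡ true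
⊕Σ-≡ᵇ {n} a = trans (⊕Σ-cong {n} (λ i → sym (∧-identityʳ _))) (⊕Σ-select a (λ _ → true))

⊕Σ-select₂ : ∀ {n} (g : Fin n → Fin n → Bool) (x y : Fin n) →
  ⊕Σ (λ u → ⊕Σ (λ v → g u v ∧ ((x ≡ᵇ u) ∧ (y ≡ᵇ v)))) ≡ g x y
⊕Σ-select₂ {n} g x y = begin
  ⊕Σ (λ u → ⊕Σ (λ v → g u v ∧ ((x ≡ᵇ u) ∧ (y ≡ᵇ v))))
    ≡⟨ ⊕Σ-cong (λ u → ⊕Σ-cong (λ v → trans (regroup (g u v) (x ≡ᵇ u) (y ≡ᵇ v))
                                                (cong (λ c → (x ≡ᵇ u) ∧ (c ∧ g u v)) (≡ᵇ-sym y v)))) ⟩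
  ⊕Σ (λ u → ⊕Σ (λ v → (x ≡ᵇ u) ∧ ((v ≡ᵇ y) ∧ g u v)))
    ≡⟨ ⊕Σ-cong (λ u → trans (⊕Σ-∧ˡ {n} (x ≡ᵇ u) _) (cong ((x ≡ᵇ u) ∧_) (⊕Σ-select y (g u)))) ⟩
  ⊕Σ (λ u → (x ≡ᵇ u) ∧ g u y)
    ≡⟨ trans (⊕Σ-cong (λ u → cong (_∧ g u y) (≡ᵇ-sym x u))) (⊕Σ-select x (λ u → g u y)) ⟩
  g x y ∎
  where
  open ≡-Reasoning
  regroup : ∀ a b c → a ∧ (b ∧ c) ≡ b ∧ (c ∧ a)
  regroup a b c = byTruthTable 3
    (λ { (a ∷ b ∷ c ∷ []) → a ∧ (b ∧ c) }) (λ { (a ∷ b ∷ c ∷ []) → b ∧ (c ∧ a) }) refl (a ∷ b ∷ c ∷ [])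

⊕Σ₂-∧-xor : ∀ {m n} (c f g : Fin m → Fin n → Bool) →
  ⊕Σ (λ u → ⊕Σ (λ v → c u v ∧ (f u v xor g u v)))
    ≡ ⊕Σ (λ u → ⊕Σ (λ v → c u v ∧ f u v)) xor ⊕Σ (λ u → ⊕Σ (λ v → c u v ∧ g u v))
⊕Σ₂-∧-xor c f g =
  trans (⊕Σ-cong λ u → trans (⊕Σ-cong λ v → ∧-distribˡ-xor (c u v) (f u v) (g u v))
                             (⊕Σ-xor (λ v → c u v ∧ f u v) (λ v → c u v ∧ g u v)))
        (⊕Σ-xor (λ u → ⊕Σ (λ v → c u v ∧ f u v)) (λ u → ⊕Σ (λ v → c u v ∧ g u v)))

⊕L : ∀ {A : Set} → List A → (A → Bool) → Bool
⊕L [] g = false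
⊕L (x ∷ xs) g = g x xor ⊕L xs g

⊕L-++ : ∀ {A : Set} (xs ys : List A) g → ⊕L (xs ++ ys) g ≡ ⊕L xs g xor ⊕L ys g
⊕L-++ [] ys g = refl
⊕L-++ (x ∷ xs) ys g = trans (cong (g x xor_) (⊕L-++ xs ys g)) (sym (xor-assoc (g x) _ _))

⊕L-cong : ∀ {A : Set} (xs : List A) {g h : A → Bool} → (∀ x → g x ≡ h x) → ⊕L xs g ≡ ⊕L xs h
⊕L-cong [] e = refl
⊕L-cong (x ∷ xs) e = cong₂ _xor_ (e x) (⊕L-cong xs e)

⊕L-false : ∀ {A : Set} (xs : List A) {g : A → Bool} → (∀ x → g x ≡ false) → ⊕L xs g ≡ false
⊕L-false [] e = refl
⊕L-false (x ∷ xs) e rewrite e x = ⊕L-false xs e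

⊕L-map : ∀ {A B : Set} (f : A → B) (xs : List A) (g : B → Bool) → ⊕L (map f xs) g ≡ ⊕L xs (g ∘ f)
⊕L-map f [] g = refl
⊕L-map f (x ∷ xs) g = cong (g (f x) xor_) (⊕L-map f xs g)

⊕Σ-⊕L : ∀ {A : Set} {n} (xs : List A) (g : A → Fin n → Bool) →
  ⊕Σ (λ v → ⊕L xs (λ x → g x v)) ≡ ⊕L xs (λ x → ⊕Σ (g x))
⊕Σ-⊕L {n = n} [] g = ⊕Σ-false {n} (λ _ → refl)
⊕Σ-⊕L (x ∷ xs) g = trans (⊕Σ-xor (g x) _) (cong (⊕Σ (g x) xor_) (⊕Σ-⊕L xs g))

parity : ∀ {A : Set} → List A → Bool
parity xs = ⊕L xs (λ _ → true)

parity-++ : ∀ {A : Set} (xs ys : List A) → parity (xs ++ ys) ≡ parity xs xor parity ys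
parity-++ xs ys = ⊕L-++ xs ys _

parity-map : ∀ {A B : Set} (f : A → B) (xs : List A) → parity (map f xs) ≡ parity xs
parity-map f xs = ⊕L-map f xs _

Relation : ℕ → Set
Relation n = Fin n → Fin n → Bool

deg : ∀ {n} → Relation n → Fin n → Bool
deg E v = ⊕Σ (E v)

⊕Σ< : ∀ {n} → Relation n → Bool
⊕Σ< {zero} E = false
⊕Σ< {suc n} E = ⊕Σ (λ v → E zero (suc v)) xor ⊕Σ< (λ u v → E (suc u) (suc v))

⊕Σ<-false : ∀ {n} {E : Relation n} → (∀ s t → E s t ≡ false) → ⊕Σ< E ≡ false
⊕Σ<-false {zero} h = refl
⊕Σ<-false {suc n} h rewrite ⊕Σ-false (λ v → h zero (suc v)) = ⊕Σ<-false (λ s t → h (suc s) (suc t))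

⊕Σ<-xor : ∀ {n} (E F : Relation n) → ⊕Σ< (λ s t → E s t xor F s t) ≡ ⊕Σ< E xor ⊕Σ< F
⊕Σ<-xor {zero} E F = refl
⊕Σ<-xor {suc n} E F
  rewrite ⊕Σ-xor (λ v → E zero (suc v)) (λ v → F zero (suc v))
        | ⊕Σ<-xor (λ s t → E (suc s) (suc t)) (λ s t → F (suc s) (suc t))
  = xor-interchange (⊕Σ (λ v → E zero (suc v))) (⊕Σ (λ v → F zero (suc v))) _ _

⊕Σ<-∧ˡ : ∀ {n} c (E : Relation n) → ⊕Σ< (λ s t → c ∧ E s t) ≡ c ∧ ⊕Σ< E
⊕Σ<-∧ˡ true E = refl
⊕Σ<-∧ˡ {n} false E = ⊕Σ<-false {n} (λ _ _ → refl)

⊕Σ<-⊕Σ : ∀ {m n} (E : Fin m → Relation n) → ⊕Σ< (λ s t → ⊕Σ (λ i → E i s t)) ≡ ⊕Σ (λ i → ⊕Σ< (E i))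
⊕Σ<-⊕Σ {m} {zero} E = sym (⊕Σ-false {m} (λ _ → refl))
⊕Σ<-⊕Σ {m} {suc n} E
  rewrite ⊕Σ-swap (λ v i → E i zero (suc v))
        | ⊕Σ<-⊕Σ (λ i s t → E i (suc s) (suc t))
  = sym (⊕Σ-xor (λ i → ⊕Σ (λ v → E i zero (suc v))) (λ i → ⊕Σ< (λ s t → E i (suc s) (suc t))))

⊕Σ<-⊕L : ∀ {A : Set} {n} (xs : List A) (E : A → Relation n) →
  ⊕Σ< (λ s t → ⊕L xs (λ x → E x s t)) ≡ ⊕L xs (λ x → ⊕Σ< (E x))
⊕Σ<-⊕L {n = n} [] E = ⊕Σ<-false {n} (λ _ _ → refl)
⊕Σ<-⊕L (x ∷ xs) E = trans (⊕Σ<-xor (E x) _) (cong (⊕Σ< (E x) xor_) (⊕Σ<-⊕L xs E))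

handshake : ∀ {n} (E : Relation n) → (∀ s t → E s t ≡ E t s) → (∀ s → E s s ≡ false) →
  ⊕Σ (deg E) ≡ false
handshake {zero} E E-sym E-irrefl = refl
handshake {suc n} E E-sym E-irrefl = begin
  (E zero zero xor row) xor ⊕Σ (λ v → E (suc v) zero xor deg (λ s t → E (suc s) (suc t)) v)
    ≡⟨ cong₂ _xor_ (cong (_xor row) (E-irrefl zero))
                   (trans (⊕Σ-xor (λ v → E (suc v) zero) _)
                          (cong₂ _xor_ (⊕Σ-cong (λ v → E-sym (suc v) zero))
                                       (handshake (λ s t → E (suc s) (suc t))
                                                  (λ s t → E-sym (suc s) (suc t)) (E-irrefl ∘ suc)))) ⟩
  row xor (row xor false)
    ≡⟨ trans (cong (row xor_) (xor-identityʳ row)) (xor-same row) ⟩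
  false ∎
  where
  open ≡-Reasoning
  row = ⊕Σ (λ v → E zero (suc v))

Pair : ℕ → Set
Pair n = Fin n × Fin n

edge : ∀ {n} → Fin n → Fin n → Relation n
edge a b s t = ((s ≡ᵇ a) ∧ (t ≡ᵇ b)) xor ((s ≡ᵇ b) ∧ (t ≡ᵇ a))

edges : ∀ {n} → List (Pair n) → Relation n
edges F s t = ⊕L F (λ { (a , b) → edge a b s t })

incidence : ∀ {n} → Fin n → List (Pair n) → Bool
incidence v F = ⊕L F (λ { (a , b) → (v ≡ᵇ a) xor (v ≡ᵇ b) })

distinctPairs : ∀ {n} → List (Pair n) → Bool
distinctPairs F = ⊕L F (λ { (a , b) → not (a ≡ᵇ b) })

edges-++ : ∀ {n} (F G : List (Pair n)) s t → edges (F ++ G) s t ≡ edges F s t xor edges G s t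
edges-++ F G s t = ⊕L-++ F G _

incidence-++ : ∀ {n} (v : Fin n) F G → incidence v (F ++ G) ≡ incidence v F xor incidence v G
incidence-++ v F G = ⊕L-++ F G _

edges-sym : ∀ {n} (F : List (Pair n)) s t → edges F s t ≡ edges F t s
edges-sym [] s t = refl
edges-sym ((a , b) ∷ F) s t = cong₂ _xor_ (byTruthTable 4
  (λ { (w ∷ x ∷ y ∷ z ∷ []) → (w ∧ x) xor (y ∧ z) }) (λ { (w ∷ x ∷ y ∷ z ∷ []) → (z ∧ y) xor (x ∧ w) }) refl
  ((s ≡ᵇ a) ∷ (t ≡ᵇ b) ∷ (s ≡ᵇ b) ∷ (t ≡ᵇ a) ∷ [])) (edges-sym F s t)

edges-irrefl : ∀ {n} (F : List (Pair n)) s → edges F s s ≡ false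
edges-irrefl [] s = refl
edges-irrefl ((a , b) ∷ F) s =
  cong₂ _xor_ (trans (cong (((s ≡ᵇ a) ∧ (s ≡ᵇ b)) xor_) (∧-comm (s ≡ᵇ b) (s ≡ᵇ a))) (xor-same ((s ≡ᵇ a) ∧ (s ≡ᵇ b))))
              (edges-irrefl F s)

deg-edge : ∀ {n} (a b v : Fin n) → deg (edge a b) v ≡ (v ≡ᵇ a) xor (v ≡ᵇ b)
deg-edge a b v = trans (⊕Σ-xor (λ t → (v ≡ᵇ a) ∧ (t ≡ᵇ b)) (λ t → (v ≡ᵇ b) ∧ (t ≡ᵇ a)))
  (cong₂ _xor_ (trans (⊕Σ-∧ˡ (v ≡ᵇ a) (_≡ᵇ b)) (trans (cong ((v ≡ᵇ a) ∧_) (⊕Σ-≡ᵇ b)) (∧-identityʳ _)))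
               (trans (⊕Σ-∧ˡ (v ≡ᵇ b) (_≡ᵇ a)) (trans (cong ((v ≡ᵇ b) ∧_) (⊕Σ-≡ᵇ a)) (∧-identityʳ _))))

deg-edges : ∀ {n} (F : List (Pair n)) v → deg (edges F) v ≡ incidence v F
deg-edges F v = trans (⊕Σ-⊕L F (λ { (a , b) t → edge a b v t })) (⊕L-cong F (λ { (a , b) → deg-edge a b v }))

⊕Σ<-edge : ∀ {n} (a b : Fin n) → ⊕Σ< (edge a b) ≡ not (a ≡ᵇ b)
⊕Σ<-edge {suc n} zero zero = cong₂ _xor_ (⊕Σ-false {n} (λ _ → refl)) (⊕Σ<-false {n} (λ _ _ → refl))
⊕Σ<-edge {suc n} zero (suc b) =
  cong₂ _xor_ (trans (⊕Σ-cong {n} {g = _≡ᵇ b} (λ v → xor-identityʳ _)) (⊕Σ-≡ᵇ b))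
              (⊕Σ<-false {n} (λ s t → ∧-zeroʳ _))
⊕Σ<-edge {suc n} (suc a) zero =
  cong₂ _xor_ (⊕Σ-≡ᵇ a) (⊕Σ<-false {n} (λ s t → trans (xor-identityʳ ((s ≡ᵇ a) ∧ false)) (∧-zeroʳ _)))
⊕Σ<-edge {suc n} (suc a) (suc b) =
  trans (cong (_xor ⊕Σ< (edge a b)) (⊕Σ-false {n} (λ _ → refl))) (⊕Σ<-edge a b)

⊕Σ<-edges : ∀ {n} (F : List (Pair n)) → ⊕Σ< (edges F) ≡ distinctPairs F
⊕Σ<-edges F = trans (⊕Σ<-⊕L F (λ { (a , b) s t → edge a b s t })) (⊕L-cong F (λ { (a , b) → ⊕Σ<-edge a b }))

record Eulerian {n} (E : Relation n) : Set where
  field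
    symmetric : ∀ s t → E s t ≡ E t s
    irreflexive : ∀ s → E s s ≡ false
    evenDegrees : ∀ v → deg E v ≡ false

eulerian-xor : ∀ {n} {E F : Relation n} → Eulerian E → Eulerian F → Eulerian (λ s t → E s t xor F s t)
eulerian-xor {E = E} {F} e f = record
  { symmetric = λ s t → cong₂ _xor_ (symmetric e s t) (symmetric f s t)
  ; irreflexive = λ s → cong₂ _xor_ (irreflexive e s) (irreflexive f s)
  ; evenDegrees = λ v → trans (⊕Σ-xor (E v) (F v)) (cong₂ _xor_ (evenDegrees e v) (evenDegrees f v))
  }
  where open Eulerian

eulerian-⊕Σ : ∀ {m n} {E : Fin m → Relation n} → (∀ i → Eulerian (E i)) →
  Eulerian (λ s t → ⊕Σ (λ i → E i s t))
eulerian-⊕Σ {E = E} e = record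
  { symmetric = λ s t → ⊕Σ-cong (λ i → symmetric (e i) s t)
  ; irreflexive = λ s → ⊕Σ-false (λ i → irreflexive (e i) s)
  ; evenDegrees = λ v → trans (⊕Σ-swap (λ t i → E i v t)) (⊕Σ-false (λ i → evenDegrees (e i) v))
  }
  where open Eulerian

eulerian-∧ˡ : ∀ {n} {E : Relation n} c → Eulerian E → Eulerian (λ s t → c ∧ E s t)
eulerian-∧ˡ true e = e
eulerian-∧ˡ {n} false e = record
  { symmetric = λ _ _ → refl ; irreflexive = λ _ → refl ; evenDegrees = λ _ → ⊕Σ-false {n} (λ _ → refl) }

eulerian-edges : ∀ {n} (F : List (Pair n)) → (∀ v → incidence v F ≡ false) → Eulerian (edges F)
eulerian-edges F even = record
  { symmetric = edges-sym F ; irreflexive = edges-irrefl F ; evenDegrees = λ v → trans (deg-edges F v) (even v) }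

square : ∀ {n} → Fin n → Fin n → Fin n → Fin n → List (Pair n)
square a b c d = (a , b) ∷ (b , c) ∷ (c , d) ∷ (d , a) ∷ []

eulerian-square : ∀ {n} (a b c d : Fin n) → Eulerian (edges (square a b c d))
eulerian-square a b c d = eulerian-edges (square a b c d) (λ v → byTruthTable 4
  (λ { (w ∷ x ∷ y ∷ z ∷ []) → (w xor x) xor ((x xor y) xor ((y xor z) xor ((z xor w) xor false))) })
  (λ _ → false) refl ((v ≡ᵇ a) ∷ (v ≡ᵇ b) ∷ (v ≡ᵇ c) ∷ (v ≡ᵇ d) ∷ []))

⊕Σ<-square : ∀ {n} (a b c d : Fin n) → a ≢ b → b ≢ c → c ≢ d → d ≢ a → ⊕Σ< (edges (square a b c d)) ≡ false
⊕Σ<-square a b c d a≢b b≢c c≢d d≢a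
  rewrite ⊕Σ<-edges (square a b c d)
        | ≢⇒≡ᵇ-false a≢b | ≢⇒≡ᵇ-false b≢c | ≢⇒≡ᵇ-false c≢d | ≢⇒≡ᵇ-false d≢a = refl

flipPattern : ∀ {n} → List (Subset n) → Relation n
flipPattern Xs s t = ⊕L Xs (λ X → lookup X s ∧ lookup X t)

invertAll-flipPattern : ∀ {n} (D : Digraph n) Xs s t →
  invertAll D Xs s t ≡ (if flipPattern Xs s t then D t s else D s t)
invertAll-flipPattern D [] s t = refl
invertAll-flipPattern D (X ∷ Xs) s t
  rewrite invertAll-flipPattern (invert D X) Xs s t | ∧-comm (lookup X t) (lookup X s)
  = if-xor (lookup X s ∧ lookup X t) (flipPattern Xs s t)
  where
  if-xor : ∀ x c → (if c then (if x then D s t else D t s) else (if x then D t s else D s t))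
                   ≡ (if x xor c then D t s else D s t)
  if-xor true true = refl
  if-xor true false = refl
  if-xor false true = refl
  if-xor false false = refl

-- The diagonal is irrelevant: inversions never create loops.
Realisable : ∀ {n} → ℕ → Relation n → Set
Realisable {n} p E = Σ (List (Subset n)) λ Xs → All (HasSize p) Xs × (∀ s t → s ≢ t → flipPattern Xs s t ≡ E s t)

realisable-cong : ∀ {n p} {E F : Relation n} → (∀ s t → E s t ≡ F s t) → Realisable p E → Realisable p F
realisable-cong E≡F (Xs , sizes , realises) = Xs , sizes , λ s t s≢t → trans (realises s t s≢t) (E≡F s t)

realisable-xor : ∀ {n p} {E F : Relation n} → Realisable p E → Realisable p F →
  Realisable p (λ s t → E s t xor F s t)
realisable-xor (Xs , Xs-sizes , Xs-pattern) (Ys , Ys-sizes , Ys-pattern) =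
  Xs ++ Ys , ++⁺ Xs-sizes Ys-sizes ,
  λ s t s≢t → trans (⊕L-++ Xs Ys _) (cong₂ _xor_ (Xs-pattern s t s≢t) (Ys-pattern s t s≢t))

realisable-⊕Σ : ∀ {m n p} {E : Fin m → Relation n} → (∀ i → Realisable p (E i)) →
  Realisable p (λ s t → ⊕Σ (λ i → E i s t))
realisable-⊕Σ {zero} r = [] , [] , λ _ _ _ → refl
realisable-⊕Σ {suc m} r = realisable-xor (r zero) (realisable-⊕Σ (r ∘ suc))

realisable-∧ˡ : ∀ {n p} {E : Relation n} c → (c ≡ true → Realisable p E) → Realisable p (λ s t → c ∧ E s t)
realisable-∧ˡ true r = r refl
realisable-∧ˡ false r = [] , [] , λ _ _ _ → refl

count : ∀ {n} → (Fin n → Bool) → ℕ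
count {zero} f = 0
count {suc n} f = (if f zero then 1 else 0) + count (f ∘ suc)

count-false : ∀ n → count {n} (λ _ → false) ≡ 0
count-false zero = refl
count-false (suc n) = count-false n

∣tabulate∣≡count : ∀ {n} (f : Fin n → Bool) → ∣ tabulate f ∣ ≡ count f
∣tabulate∣≡count {zero} f = refl
∣tabulate∣≡count {suc n} f with f zero
... | true = cong suc (∣tabulate∣≡count (f ∘ suc))
... | false = ∣tabulate∣≡count (f ∘ suc)

count-∨ : ∀ {n} (f g : Fin n → Bool) → (∀ i → f i ∧ g i ≡ false) → count (λ i → f i ∨ g i) ≡ count f + count g
count-∨ {zero} f g disjoint = refl
count-∨ {suc n} f g disjoint with f zero | g zero | disjoint zero
... | true | false | _ = cong suc (count-∨ (f ∘ suc) (g ∘ suc) (disjoint ∘ suc))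
... | false | true | _ = trans (cong suc (count-∨ (f ∘ suc) (g ∘ suc) (disjoint ∘ suc))) (sym (ℕ.+-suc _ _))
... | false | false | _ = count-∨ (f ∘ suc) (g ∘ suc) (disjoint ∘ suc)

count-∨-≤ : ∀ {n} (f g : Fin n → Bool) → count (λ i → f i ∨ g i) ≤ count f + count g
count-∨-≤ {zero} f g = z≤n
count-∨-≤ {suc n} f g with f zero | g zero
... | true | true = s≤s (ℕ.≤-trans (count-∨-≤ (f ∘ suc) (g ∘ suc)) (ℕ.≤-trans (ℕ.n≤1+n _) (ℕ.≤-reflexive (sym (ℕ.+-suc _ _)))))
... | true | false = s≤s (count-∨-≤ (f ∘ suc) (g ∘ suc))
... | false | true = ℕ.≤-trans (s≤s (count-∨-≤ (f ∘ suc) (g ∘ suc))) (ℕ.≤-reflexive (sym (ℕ.+-suc _ _)))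
... | false | false = count-∨-≤ (f ∘ suc) (g ∘ suc)

count-≡ᵇ : ∀ {n} (a : Fin n) → count (_≡ᵇ a) ≡ 1
count-≡ᵇ {suc n} zero = cong suc (count-false n)
count-≡ᵇ {suc n} (suc a) = count-≡ᵇ a

count-not : ∀ {n} (f : Fin n → Bool) → count (not ∘ f) + count f ≡ n
count-not {zero} f = refl
count-not {suc n} f with f zero
... | true = trans (ℕ.+-suc _ _) (cong suc (count-not (f ∘ suc)))
... | false = cong suc (count-not (f ∘ suc))

first : ∀ {n} → ℕ → (Fin n → Bool) → Fin n → Bool
first zero f i = false
first (suc k) f zero = f zero
first (suc k) f (suc i) = first (if f zero then k else suc k) (f ∘ suc) i

first-⊆ : ∀ {n} k (f : Fin n → Bool) i → first k f i ≡ true → f i ≡ true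
first-⊆ (suc k) f zero h = h
first-⊆ (suc k) f (suc i) h = first-⊆ (if f zero then k else suc k) (f ∘ suc) i h

count-first : ∀ {n} k (f : Fin n → Bool) → k ≤ count f → count (first k f) ≡ k
count-first {n} zero f h = count-false n
count-first {suc n} (suc k) f h with f zero
count-first {suc n} (suc k) f (s≤s h) | true = cong suc (count-first k (f ∘ suc) h)
count-first {suc n} (suc k) f h | false = count-first (suc k) (f ∘ suc) h

module SquareGadget {n : ℕ} (q : ℕ) (a b c d : Fin n) where

  corner : Fin n → Bool
  corner w = (w ≡ᵇ a) ∨ ((w ≡ᵇ b) ∨ ((w ≡ᵇ c) ∨ (w ≡ᵇ d)))

  padding : Fin n → Bool
  padding = first q (not ∘ corner)

  padded : Fin n → Fin n → Subset n
  padded x y = tabulate (λ w → padding w ∨ ((w ≡ᵇ x) ∨ (w ≡ᵇ y)))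

  sets : List (Subset n)
  sets = padded a b ∷ padded b c ∷ padded c d ∷ padded d a ∷ []

  padding-avoids : ∀ x → corner x ≡ true → ∀ w → padding w ∧ (w ≡ᵇ x) ≡ false
  padding-avoids x x-corner w = ∧-false (padding w) λ padded-w → outside (first-⊆ q (not ∘ corner) w padded-w)
    where
    outside : not (corner w) ≡ true → (w ≡ᵇ x) ≡ false
    outside not-corner with w ≡ᵇ x in e
    ... | false = refl
    ... | true with trans (sym (subst (λ z → not (corner z) ≡ true) (≡ᵇ⇒≡ {x = w} e) not-corner)) (cong not x-corner)
    ...   | ()

  a-corner : corner a ≡ true
  a-corner rewrite ≡ᵇ-refl a = refl
  b-corner : corner b ≡ true
  b-corner rewrite ≡ᵇ-refl b = ∨-zeroʳ (b ≡ᵇ a)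
  c-corner : corner c ≡ true
  c-corner rewrite ≡ᵇ-refl c = trans (cong ((c ≡ᵇ a) ∨_) (∨-zeroʳ (c ≡ᵇ b))) (∨-zeroʳ (c ≡ᵇ a))
  d-corner : corner d ≡ true
  d-corner rewrite ≡ᵇ-refl d =
    trans (cong (λ z → (d ≡ᵇ a) ∨ ((d ≡ᵇ b) ∨ z)) (∨-zeroʳ (d ≡ᵇ c)))
          (trans (cong ((d ≡ᵇ a) ∨_) (∨-zeroʳ (d ≡ᵇ b))) (∨-zeroʳ (d ≡ᵇ a)))

  module _ {x y : Fin n} (x≢y : x ≢ y) (x-corner : corner x ≡ true) (y-corner : corner y ≡ true) where

    lookup-padded : ∀ w → lookup (padded x y) w ≡ padding w xor ((w ≡ᵇ x) xor (w ≡ᵇ y))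
    lookup-padded w = trans (lookup∘tabulate _ w)
      (disjoint-∨⇒xor (padding w) (w ≡ᵇ x) (w ≡ᵇ y)
        (padding-avoids x x-corner w) (padding-avoids y y-corner w) (≢⇒disjoint x≢y w))

    ∣padded∣ : q + 4 ≤ n → ∣ padded x y ∣ ≡ 2 + q
    ∣padded∣ q+4≤n = begin
      ∣ padded x y ∣                                          ≡⟨ ∣tabulate∣≡count {n} _ ⟩
      count (λ w → padding w ∨ ((w ≡ᵇ x) ∨ (w ≡ᵇ y)))        ≡⟨ count-∨ padding _ padding-avoids-xy ⟩
      count padding + count (λ w → (w ≡ᵇ x) ∨ (w ≡ᵇ y))      ≡⟨ cong₂ _+_ (count-first q (not ∘ corner) q≤available)
                                                                        (count-∨ _ _ (≢⇒disjoint x≢y)) ⟩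
      q + (count (_≡ᵇ x) + count (_≡ᵇ y))                    ≡⟨ cong (q +_) (cong₂ _+_ (count-≡ᵇ x) (count-≡ᵇ y)) ⟩
      q + 2                                                   ≡⟨ ℕ.+-comm q 2 ⟩
      2 + q ∎
      where
      open ≡-Reasoning
      padding-avoids-xy : ∀ w → padding w ∧ ((w ≡ᵇ x) ∨ (w ≡ᵇ y)) ≡ false
      padding-avoids-xy w = trans (∧-distribˡ-∨ (padding w) _ _)
        (cong₂ _∨_ (padding-avoids x x-corner w) (padding-avoids y y-corner w))
      corners≤4 : count corner ≤ 4
      corners≤4 =
        ℕ.≤-trans (count-∨-≤ {n} _ _) (ℕ.+-mono-≤ (single a)
        (ℕ.≤-trans (count-∨-≤ {n} _ _) (ℕ.+-mono-≤ (single b)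
        (ℕ.≤-trans (count-∨-≤ {n} _ _) (ℕ.+-mono-≤ (single c) (single d))))))
        where
        single : ∀ z → count (_≡ᵇ z) ≤ 1
        single z = ℕ.≤-reflexive (count-≡ᵇ z)
      q≤available : q ≤ count (not ∘ corner)
      q≤available = ℕ.+-cancelʳ-≤ 4 q _
        (ℕ.≤-trans q+4≤n (ℕ.≤-trans (ℕ.≤-reflexive (sym (count-not corner))) (ℕ.+-monoʳ-≤ _ corners≤4)))

  module _ (a≢b : a ≢ b) (b≢c : b ≢ c) (c≢d : c ≢ d) (d≢a : d ≢ a) where

    -- Each padding vertex lies in all four sets and each corner in exactly two, so only the square survives.
    flipPattern-sets : ∀ s t → flipPattern sets s t ≡ edges (square a b c d) s t
    flipPattern-sets s t
      rewrite lookup-padded a≢b a-corner b-corner s | lookup-padded a≢b a-corner b-corner t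
            | lookup-padded b≢c b-corner c-corner s | lookup-padded b≢c b-corner c-corner t
            | lookup-padded c≢d c-corner d-corner s | lookup-padded c≢d c-corner d-corner t
            | lookup-padded d≢a d-corner a-corner s | lookup-padded d≢a d-corner a-corner t
      = byTruthTable 10
          (λ { (ps ∷ as ∷ bs ∷ cs ∷ ds ∷ pt ∷ at ∷ bt ∷ ct ∷ dt ∷ []) →
            ((ps xor (as xor bs)) ∧ (pt xor (at xor bt))) xor (((ps xor (bs xor cs)) ∧ (pt xor (bt xor ct)))
            xor (((ps xor (cs xor ds)) ∧ (pt xor (ct xor dt))) xor (((ps xor (ds xor as)) ∧ (pt xor (dt xor at))) xor false))) })
          (λ { (ps ∷ as ∷ bs ∷ cs ∷ ds ∷ pt ∷ at ∷ bt ∷ ct ∷ dt ∷ []) →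
            ((as ∧ bt) xor (bs ∧ at)) xor (((bs ∧ ct) xor (cs ∧ bt)) xor (((cs ∧ dt) xor (ds ∧ ct))
            xor (((ds ∧ at) xor (as ∧ dt)) xor false))) })
          refl
          (padding s ∷ (s ≡ᵇ a) ∷ (s ≡ᵇ b) ∷ (s ≡ᵇ c) ∷ (s ≡ᵇ d) ∷ padding t ∷ (t ≡ᵇ a) ∷ (t ≡ᵇ b) ∷ (t ≡ᵇ c) ∷ (t ≡ᵇ d) ∷ [])

    sets-size : q + 4 ≤ n → All (HasSize (2 + q)) sets
    sets-size q+4≤n = ∣padded∣ a≢b a-corner b-corner q+4≤n ∷ ∣padded∣ b≢c b-corner c-corner q+4≤n
                    ∷ ∣padded∣ c≢d c-corner d-corner q+4≤n ∷ ∣padded∣ d≢a d-corner a-corner q+4≤n ∷ []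

realisable-square : ∀ {n} q (a b c d : Fin n) → a ≢ b → b ≢ c → c ≢ d → d ≢ a → q + 4 ≤ n →
  Realisable (2 + q) (edges (square a b c d))
realisable-square q a b c d a≢b b≢c c≢d d≢a q+4≤n =
  SquareGadget.sets q a b c d , SquareGadget.sets-size q a b c d a≢b b≢c c≢d d≢a q+4≤n ,
  λ s t _ → SquareGadget.flipPattern-sets q a b c d a≢b b≢c c≢d d≢a s t

-- Squares through v₀ and v₁ remove the edges among the other vertices, then squares through
-- v₀, v₁, v₂ remove the edges from v₀ to the vertices beyond v₂; even degrees and the even number
-- of edges force what is left to vanish.
module SquareDecomposition (k : ℕ) (E : Relation (3 + k)) (E-eulerian : Eulerian E) (E-even : ⊕Σ< E ≡ false) where

  open Eulerian

  v₀ v₁ v₂ : Fin (3 + k)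
  v₀ = zero
  v₁ = suc zero
  v₂ = suc (suc zero)

  outer : Fin k → Fin (3 + k)
  outer w = shift₂ (suc w)

  chordA : Fin (suc k) → Fin (suc k) → Bool
  chordA u v = (u <ᵇ v) ∧ E (shift₂ u) (shift₂ v)

  squareA : Fin (suc k) → Fin (suc k) → List (Pair (3 + k))
  squareA u v = square (shift₂ u) (shift₂ v) v₁ v₀

  A : Relation (3 + k)
  A s t = ⊕Σ (λ u → ⊕Σ (λ v → chordA u v ∧ edges (squareA u v) s t))

  chordA-distinct : ∀ u v → chordA u v ≡ true → shift₂ u ≢ shift₂ v
  chordA-distinct u v h = <ᵇ⇒≢ (∧-conicalˡ _ _ h) ∘ shift₂-injective

  A-realisable : ∀ q → q + 4 ≤ 3 + k → Realisable (2 + q) A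
  A-realisable q q+4≤n = realisable-⊕Σ λ u → realisable-⊕Σ λ v → realisable-∧ˡ (chordA u v) λ h →
    realisable-square q (shift₂ u) (shift₂ v) v₁ v₀ (chordA-distinct u v h) (λ ()) (λ ()) (λ ()) q+4≤n

  A-eulerian : Eulerian A
  A-eulerian = eulerian-⊕Σ λ u → eulerian-⊕Σ λ v → eulerian-∧ˡ (chordA u v) (eulerian-square (shift₂ u) (shift₂ v) v₁ v₀)

  A-even : ⊕Σ< A ≡ false
  A-even = trans (⊕Σ<-⊕Σ (λ u s t → ⊕Σ (λ v → chordA u v ∧ edges (squareA u v) s t)))
    (⊕Σ-false λ u → trans (⊕Σ<-⊕Σ (λ v s t → chordA u v ∧ edges (squareA u v) s t))
      (⊕Σ-false λ v → trans (⊕Σ<-∧ˡ (chordA u v) (edges (squareA u v)))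
        (∧-false (chordA u v) λ h → ⊕Σ<-square (shift₂ u) (shift₂ v) v₁ v₀ (chordA-distinct u v h) (λ ()) (λ ()) (λ ()))))

  A-inner : ∀ x y → A (shift₂ x) (shift₂ y) ≡ E (shift₂ x) (shift₂ y)
  A-inner x y = begin
    A (shift₂ x) (shift₂ y)
      ≡⟨ ⊕Σ-cong (λ u → ⊕Σ-cong (λ v → cong (chordA u v ∧_) (squareA-inner u v))) ⟩
    ⊕Σ (λ u → ⊕Σ (λ v → chordA u v ∧ (((x ≡ᵇ u) ∧ (y ≡ᵇ v)) xor ((y ≡ᵇ u) ∧ (x ≡ᵇ v)))))
      ≡⟨ ⊕Σ₂-∧-xor chordA (λ u v → (x ≡ᵇ u) ∧ (y ≡ᵇ v)) (λ u v → (y ≡ᵇ u) ∧ (x ≡ᵇ v)) ⟩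
    ⊕Σ (λ u → ⊕Σ (λ v → chordA u v ∧ ((x ≡ᵇ u) ∧ (y ≡ᵇ v)))) xor ⊕Σ (λ u → ⊕Σ (λ v → chordA u v ∧ ((y ≡ᵇ u) ∧ (x ≡ᵇ v))))
      ≡⟨ cong₂ _xor_ (⊕Σ-select₂ chordA x y) (⊕Σ-select₂ chordA y x) ⟩
    ((x <ᵇ y) ∧ E (shift₂ x) (shift₂ y)) xor ((y <ᵇ x) ∧ E (shift₂ y) (shift₂ x))
      ≡⟨ cong (λ e → ((x <ᵇ y) ∧ E (shift₂ x) (shift₂ y)) xor ((y <ᵇ x) ∧ e)) (symmetric E-eulerian _ _) ⟩
    ((x <ᵇ y) ∧ E (shift₂ x) (shift₂ y)) xor ((y <ᵇ x) ∧ E (shift₂ x) (shift₂ y))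
      ≡⟨ sym (∧-distribʳ-xor (E (shift₂ x) (shift₂ y)) (x <ᵇ y) (y <ᵇ x)) ⟩
    ((x <ᵇ y) xor (y <ᵇ x)) ∧ E (shift₂ x) (shift₂ y)
      ≡⟨ cong (_∧ E (shift₂ x) (shift₂ y)) (<ᵇ-trichotomy x y) ⟩
    not (x ≡ᵇ y) ∧ E (shift₂ x) (shift₂ y)
      ≡⟨ loopless ⟩
    E (shift₂ x) (shift₂ y) ∎
    where
    open ≡-Reasoning
    squareA-inner : ∀ u v → edges (squareA u v) (shift₂ x) (shift₂ y) ≡ ((x ≡ᵇ u) ∧ (y ≡ᵇ v)) xor ((y ≡ᵇ u) ∧ (x ≡ᵇ v))
    squareA-inner u v rewrite ∧-zeroʳ (x ≡ᵇ v) | ∧-zeroʳ (x ≡ᵇ u) =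
      trans (xor-identityʳ _) (cong (((x ≡ᵇ u) ∧ (y ≡ᵇ v)) xor_) (∧-comm (x ≡ᵇ v) (y ≡ᵇ u)))
    loopless : not (x ≡ᵇ y) ∧ E (shift₂ x) (shift₂ y) ≡ E (shift₂ x) (shift₂ y)
    loopless with x ≡ᵇ y in e
    ... | false = refl
    ... | true rewrite ≡ᵇ⇒≡ {x = x} e = sym (irreflexive E-eulerian (shift₂ y))

  E₁ : Relation (3 + k)
  E₁ s t = E s t xor A s t

  E₁-eulerian : Eulerian E₁
  E₁-eulerian = eulerian-xor E-eulerian A-eulerian

  E₁-inner : ∀ x y → E₁ (shift₂ x) (shift₂ y) ≡ false
  E₁-inner x y = trans (cong (E (shift₂ x) (shift₂ y) xor_) (A-inner x y)) (xor-same (E (shift₂ x) (shift₂ y)))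

  E₁-v₁≡v₀ : ∀ x → E₁ v₁ (shift₂ x) ≡ E₁ v₀ (shift₂ x)
  E₁-v₁≡v₀ x = trans (symmetric E₁-eulerian v₁ (shift₂ x))
    (trans (sym (xor≡false⇒≡ deg-x)) (symmetric E₁-eulerian (shift₂ x) v₀))
    where
    deg-x : E₁ (shift₂ x) v₀ xor E₁ (shift₂ x) v₁ ≡ false
    deg-x = trans (sym (trans (cong (λ r → E₁ (shift₂ x) v₀ xor (E₁ (shift₂ x) v₁ xor r))
                                    (⊕Σ-false (E₁-inner x)))
                              (cong (E₁ (shift₂ x) v₀ xor_) (xor-identityʳ _))))
                  (evenDegrees E₁-eulerian (shift₂ x))

  E₁-v₀v₁ : E₁ v₀ v₁ ≡ false
  E₁-v₀v₁ = begin
    E₁ v₀ v₁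
      ≡⟨ sym (xor-identityʳ _) ⟩
    E₁ v₀ v₁ xor false
      ≡⟨ cong (E₁ v₀ v₁ xor_) (sym (xor-same row)) ⟩
    E₁ v₀ v₁ xor (row xor row)
      ≡⟨ sym (xor-assoc (E₁ v₀ v₁) row row) ⟩
    (E₁ v₀ v₁ xor row) xor row
      ≡⟨ cong ((E₁ v₀ v₁ xor row) xor_) (sym (trans (cong₂ _xor_ (⊕Σ-cong E₁-v₁≡v₀) (⊕Σ<-false E₁-inner)) (xor-identityʳ row))) ⟩
    ⊕Σ< E₁
      ≡⟨ trans (⊕Σ<-xor E A) (cong₂ _xor_ E-even A-even) ⟩
    false ∎
    where
    open ≡-Reasoning
    row = ⊕Σ (λ x → E₁ v₀ (shift₂ x))

  chordB : Fin k → Bool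
  chordB w = E₁ v₀ (outer w)

  squareB : Fin k → List (Pair (3 + k))
  squareB w = square v₀ (outer w) v₁ v₂

  B : Relation (3 + k)
  B s t = ⊕Σ (λ w → chordB w ∧ edges (squareB w) s t)

  B-realisable : ∀ q → q + 4 ≤ 3 + k → Realisable (2 + q) B
  B-realisable q q+4≤n = realisable-⊕Σ λ w → realisable-∧ˡ (chordB w) λ _ →
    realisable-square q v₀ (outer w) v₁ v₂ (λ ()) (λ ()) (λ ()) (λ ()) q+4≤n

  B-eulerian : Eulerian B
  B-eulerian = eulerian-⊕Σ λ w → eulerian-∧ˡ (chordB w) (eulerian-square v₀ (outer w) v₁ v₂)

  B-inner : ∀ x y → B (shift₂ x) (shift₂ y) ≡ false
  B-inner x y = ⊕Σ-false λ w → trans (cong (chordB w ∧_) (squareB-inner w)) (∧-zeroʳ _)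
    where
    squareB-inner : ∀ w → edges (squareB w) (shift₂ x) (shift₂ y) ≡ false
    squareB-inner w with x ≡ᵇ suc w | x ≡ᵇ zero
    ... | true | true = refl
    ... | true | false = refl
    ... | false | true = refl
    ... | false | false = refl

  B-v₀ : ∀ x → B v₀ (outer x) ≡ chordB x
  B-v₀ x = trans (⊕Σ-cong λ w → cong (chordB w ∧_) (squareB-v₀ w)) (⊕Σ-selectʳ x chordB)
    where
    squareB-v₀ : ∀ w → edges (squareB w) v₀ (outer x) ≡ (w ≡ᵇ x)
    squareB-v₀ w rewrite ≡ᵇ-sym w x with x ≡ᵇ w
    ... | true = refl
    ... | false = refl

  B-v₁ : ∀ x → B v₁ (outer x) ≡ chordB x
  B-v₁ x = trans (⊕Σ-cong λ w → cong (chordB w ∧_) (squareB-v₁ w)) (⊕Σ-selectʳ x chordB)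
    where
    squareB-v₁ : ∀ w → edges (squareB w) v₁ (outer x) ≡ (w ≡ᵇ x)
    squareB-v₁ w rewrite ≡ᵇ-sym w x with x ≡ᵇ w
    ... | true = refl
    ... | false = refl

  B-v₀v₁ : B v₀ v₁ ≡ false
  B-v₀v₁ = ⊕Σ-false λ w → ∧-zeroʳ (chordB w)

  E₂ : Relation (3 + k)
  E₂ s t = E₁ s t xor B s t

  E₂-eulerian : Eulerian E₂
  E₂-eulerian = eulerian-xor E₁-eulerian B-eulerian

  E₂-inner : ∀ x y → E₂ (shift₂ x) (shift₂ y) ≡ false
  E₂-inner x y = cong₂ _xor_ (E₁-inner x y) (B-inner x y)

  E₂-v₀-outer : ∀ x → E₂ v₀ (outer x) ≡ false
  E₂-v₀-outer x = trans (cong (E₁ v₀ (outer x) xor_) (B-v₀ x)) (xor-same (chordB x))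

  E₂-v₁-outer : ∀ x → E₂ v₁ (outer x) ≡ false
  E₂-v₁-outer x = trans (cong₂ _xor_ (E₁-v₁≡v₀ (suc x)) (B-v₁ x)) (xor-same (chordB x))

  E₂-v₀v₁ : E₂ v₀ v₁ ≡ false
  E₂-v₀v₁ = cong₂ _xor_ E₁-v₀v₁ B-v₀v₁

  E₂-v₀v₂ : E₂ v₀ v₂ ≡ false
  E₂-v₀v₂ = trans (sym deg-v₀) (evenDegrees E₂-eulerian v₀)
    where
    deg-v₀ : deg E₂ v₀ ≡ E₂ v₀ v₂
    deg-v₀ = trans (cong₂ _xor_ (irreflexive E₂-eulerian v₀)
                     (cong₂ _xor_ E₂-v₀v₁ (cong (E₂ v₀ v₂ xor_) (⊕Σ-false E₂-v₀-outer))))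
                   (xor-identityʳ _)

  E₂-v₁v₂ : E₂ v₁ v₂ ≡ false
  E₂-v₁v₂ = trans (sym deg-v₁) (evenDegrees E₂-eulerian v₁)
    where
    deg-v₁ : deg E₂ v₁ ≡ E₂ v₁ v₂
    deg-v₁ = trans (cong₂ _xor_ (trans (symmetric E₂-eulerian v₁ v₀) E₂-v₀v₁)
                     (cong₂ _xor_ (irreflexive E₂-eulerian v₁) (cong (E₂ v₁ v₂ xor_) (⊕Σ-false E₂-v₁-outer))))
                   (xor-identityʳ _)

  E₂-false : ∀ s t → E₂ s t ≡ false
  E₂-false zero zero = irreflexive E₂-eulerian v₀
  E₂-false zero (suc zero) = E₂-v₀v₁
  E₂-false zero (suc (suc zero)) = E₂-v₀v₂
  E₂-false zero (suc (suc (suc x))) = E₂-v₀-outer x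
  E₂-false (suc zero) (suc zero) = irreflexive E₂-eulerian v₁
  E₂-false (suc zero) (suc (suc zero)) = E₂-v₁v₂
  E₂-false (suc zero) (suc (suc (suc x))) = E₂-v₁-outer x
  E₂-false (suc (suc x)) (suc (suc y)) = E₂-inner x y
  E₂-false (suc zero) zero = trans (symmetric E₂-eulerian v₁ v₀) E₂-v₀v₁
  E₂-false (suc (suc zero)) zero = trans (symmetric E₂-eulerian v₂ v₀) E₂-v₀v₂
  E₂-false (suc (suc (suc x))) zero = trans (symmetric E₂-eulerian (outer x) v₀) (E₂-v₀-outer x)
  E₂-false (suc (suc zero)) (suc zero) = trans (symmetric E₂-eulerian v₂ v₁) E₂-v₁v₂
  E₂-false (suc (suc (suc x))) (suc zero) = trans (symmetric E₂-eulerian (outer x) v₁) (E₂-v₁-outer x)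

  realisable : ∀ q → q + 4 ≤ 3 + k → Realisable (2 + q) E
  realisable q q+4≤n = realisable-cong (λ s t → sym (xor₃≡false⇒≡ (E₂-false s t)))
    (realisable-xor (A-realisable q q+4≤n) (B-realisable q q+4≤n))

inFirstPair : ∀ {n} → Fin n → Bool
inFirstPair zero = true
inFirstPair (suc zero) = true
inFirstPair (suc (suc _)) = false

shiftPair : ∀ {n} → Pair n → Pair (2 + n)
shiftPair (a , b) = shift₂ a , shift₂ b

occurrence : ∀ {n} → Fin n → List (Fin n) → Bool
occurrence v K = ⊕L K (v ≡ᵇ_)

record Sweep (n : ℕ) : Set where
  constructor mkSweep
  field
    swaps : List (Pair n)
    singles : List (Fin n)
    rank : Fin n → ℕ
    shifted : Bool
open Sweep

swapIf : ∀ {n} → Bool → List (Pair (2 + n))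
swapIf sw = if sw then (zero , suc zero) ∷ [] else []

singleIf : ∀ {n} → Bool → Bool → List (Fin (2 + n))
singleIf mixed left = if mixed then (if left then zero else suc zero) ∷ [] else []

rankAfter : ∀ {n} → Bool → (Fin n → ℕ) → Fin (2 + n) → ℕ
rankAfter sw r zero = if sw then 1 else 0
rankAfter sw r (suc zero) = if sw then 0 else 1
rankAfter sw r (suc (suc i)) = 2 + r i

-- The vertices are taken in pairs {2i, 2i+1}. A pair of two odd vertices is swapped in the
-- transitive order; a pair with one odd vertex leaves that vertex as a single. With `shift`, the
-- first pair with one odd vertex is swapped as well and leaves its even vertex instead (changing
-- the parity of the number of swaps); `toggle` additionally swaps the pair {0, 1}.
sweep : ∀ n → (Fin n → Bool) → (shift toggle : Bool) → Sweep n
sweep zero odd shift toggle = mkSweep [] [] (λ ()) false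
sweep (suc zero) odd shift toggle = mkSweep [] (if odd zero then zero ∷ [] else []) (λ _ → 0) false
sweep (suc (suc n)) odd shift toggle =
  mkSweep (swapIf swap ++ map shiftPair (swaps rest)) (singleIf mixed left ++ map shift₂ (singles rest))
          (rankAfter swap (rank rest)) (shiftHere ∨ shifted rest)
  where
  a = odd zero
  b = odd (suc zero)
  mixed = a xor b
  shiftHere = shift ∧ mixed
  swap = ((a ∧ b) xor shiftHere) xor toggle
  left = a xor shiftHere
  rest = sweep n (odd ∘ shift₂) (shift ∧ not mixed) false

incidence-shift : ∀ {n} (S : List (Pair n)) w → incidence (shift₂ w) (map shiftPair S) ≡ incidence w S
incidence-shift S w = ⊕L-map shiftPair S _

incidence-shift-firstPair : ∀ {n} (S : List (Pair n)) v → inFirstPair v ≡ true → incidence v (map shiftPair S) ≡ false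
incidence-shift-firstPair S zero _ = trans (⊕L-map shiftPair S _) (⊕L-false S (λ _ → refl))
incidence-shift-firstPair S (suc zero) _ = trans (⊕L-map shiftPair S _) (⊕L-false S (λ _ → refl))

occurrence-shift : ∀ {n} (K : List (Fin n)) w → occurrence (shift₂ w) (map shift₂ K) ≡ occurrence w K
occurrence-shift K w = ⊕L-map shift₂ K _

occurrence-shift-firstPair : ∀ {n} (K : List (Fin n)) v → inFirstPair v ≡ true → occurrence v (map shift₂ K) ≡ false
occurrence-shift-firstPair K zero _ = trans (⊕L-map shift₂ K _) (⊕L-false K (λ _ → refl))
occurrence-shift-firstPair K (suc zero) _ = trans (⊕L-map shift₂ K _) (⊕L-false K (λ _ → refl))

afterStep : ∀ {n} → Bool → Bool → Bool → List (Pair n) → List (Fin n) → Fin (2 + n) → Bool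
afterStep sw mixed left S K zero = sw xor (mixed ∧ left)
afterStep sw mixed left S K (suc zero) = sw xor (mixed ∧ not left)
afterStep sw mixed left S K (suc (suc w)) = incidence w S xor occurrence w K

incidence-step : ∀ {n} sw mixed left (S : List (Pair n)) (K : List (Fin n)) v →
  incidence v (swapIf sw ++ map shiftPair S) xor occurrence v (singleIf mixed left ++ map shift₂ K)
    ≡ afterStep sw mixed left S K v
incidence-step sw mixed left S K zero
  rewrite incidence-++ zero (swapIf sw) (map shiftPair S) | ⊕L-++ (singleIf mixed left) (map shift₂ K) (zero ≡ᵇ_)
        | incidence-shift-firstPair S zero refl | occurrence-shift-firstPair K zero refl
  = firstVertex sw mixed left
  where
  firstVertex : ∀ sw mixed left →
    (incidence zero (swapIf sw) xor false) xor (occurrence zero (singleIf mixed left) xor false) ≡ sw xor (mixed ∧ left)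
  firstVertex true true true = refl
  firstVertex true true false = refl
  firstVertex true false left = refl
  firstVertex false true true = refl
  firstVertex false true false = refl
  firstVertex false false left = refl
incidence-step sw mixed left S K (suc zero)
  rewrite incidence-++ (suc zero) (swapIf sw) (map shiftPair S) | ⊕L-++ (singleIf mixed left) (map shift₂ K) (suc zero ≡ᵇ_)
        | incidence-shift-firstPair S (suc zero) refl | occurrence-shift-firstPair K (suc zero) refl
  = secondVertex sw mixed left
  where
  secondVertex : ∀ sw mixed left →
    (incidence (suc zero) (swapIf sw) xor false) xor (occurrence (suc zero) (singleIf mixed left) xor false)
      ≡ sw xor (mixed ∧ not left)
  secondVertex true true true = refl
  secondVertex true true false = refl
  secondVertex true false left = refl
  secondVertex false true true = refl
  secondVertex false true false = refl
  secondVertex false false left = refl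
incidence-step sw mixed left S K (suc (suc w))
  rewrite incidence-++ (shift₂ w) (swapIf sw) (map shiftPair S) | ⊕L-++ (singleIf mixed left) (map shift₂ K) (shift₂ w ≡ᵇ_)
        | incidence-shift S w | occurrence-shift K w
  = laterVertex sw mixed left
  where
  laterVertex : ∀ sw mixed left →
    (incidence (shift₂ w) (swapIf sw) xor incidence w S) xor (occurrence (shift₂ w) (singleIf mixed left) xor occurrence w K)
      ≡ incidence w S xor occurrence w K
  laterVertex true true true = refl
  laterVertex true true false = refl
  laterVertex true false left = refl
  laterVertex false true true = refl
  laterVertex false true false = refl
  laterVertex false false left = refl

sweep-incidence : ∀ n (odd : Fin n → Bool) shift v →
  incidence v (swaps (sweep n odd shift false)) xor occurrence v (singles (sweep n odd shift false)) ≡ odd v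
sweep-incidence-toggled : ∀ n (odd : Fin (2 + n) → Bool) shift toggle v →
  incidence v (swaps (sweep (2 + n) odd shift toggle)) xor occurrence v (singles (sweep (2 + n) odd shift toggle))
    ≡ odd v xor (toggle ∧ inFirstPair v)

sweep-incidence zero odd shift ()
sweep-incidence (suc zero) odd shift zero with odd zero
... | true = refl
... | false = refl
sweep-incidence (suc (suc n)) odd shift v = trans (sweep-incidence-toggled n odd shift false v) (xor-identityʳ (odd v))

sweep-incidence-toggled n odd shift toggle v = trans (incidence-step _ _ _ _ _ v) (byVertex v)
  where
  a = odd zero
  b = odd (suc zero)
  rest = sweep n (odd ∘ shift₂) (shift ∧ not (a xor b)) false
  byVertex : ∀ v → afterStep (((a ∧ b) xor (shift ∧ (a xor b))) xor toggle) (a xor b) (a xor (shift ∧ (a xor b)))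
                             (swaps rest) (singles rest) v ≡ odd v xor (toggle ∧ inFirstPair v)
  byVertex zero = byTruthTable 4
    (λ { (a ∷ b ∷ f ∷ t ∷ []) → (((a ∧ b) xor (f ∧ (a xor b))) xor t) xor ((a xor b) ∧ (a xor (f ∧ (a xor b)))) })
    (λ { (a ∷ b ∷ f ∷ t ∷ []) → a xor (t ∧ true) }) refl (a ∷ b ∷ shift ∷ toggle ∷ [])
  byVertex (suc zero) = byTruthTable 4
    (λ { (a ∷ b ∷ f ∷ t ∷ []) → (((a ∧ b) xor (f ∧ (a xor b))) xor t) xor ((a xor b) ∧ not (a xor (f ∧ (a xor b)))) })
    (λ { (a ∷ b ∷ f ∷ t ∷ []) → b xor (t ∧ true) }) refl (a ∷ b ∷ shift ∷ toggle ∷ [])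
  byVertex (suc (suc w)) = trans (sweep-incidence n (odd ∘ shift₂) _ w)
                                 (sym (trans (cong (odd (shift₂ w) xor_) (∧-zeroʳ toggle)) (xor-identityʳ _)))

sweep-singles-length : ∀ n (odd : Fin n → Bool) shift toggle → length (singles (sweep n odd shift toggle)) ≤ ⌈ n /2⌉
sweep-singles-length zero odd shift toggle = z≤n
sweep-singles-length (suc zero) odd shift toggle with odd zero
... | true = s≤s z≤n
... | false = z≤n
sweep-singles-length (suc (suc n)) odd shift toggle =
  ℕ.≤-trans (ℕ.≤-reflexive (length-++ (singleIf mixed _)))
    (ℕ.+-mono-≤ (atMostOne mixed)
      (ℕ.≤-trans (ℕ.≤-reflexive (length-map shift₂ (singles rest))) (sweep-singles-length n _ _ false)))
  where
  mixed = odd zero xor odd (suc zero)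
  rest = sweep n (odd ∘ shift₂) (shift ∧ not mixed) false
  atMostOne : ∀ mixed {left} → length (singleIf {n} mixed left) ≤ 1
  atMostOne true = s≤s z≤n
  atMostOne false = z≤n

unique-shift : ∀ {n} {K : List (Fin n)} → Unique K → Unique (map shift₂ K)
unique-shift [] = []
unique-shift (x∉K ∷ K-unique) = map⁺ (All.map (λ x≢y → x≢y ∘ shift₂-injective) x∉K) ∷ unique-shift K-unique

firstPair∉shift : ∀ {n} (left : Bool) (K : List (Fin n)) →
  All ((if left then zero else suc zero) ≢_) (map shift₂ K)
firstPair∉shift left [] = []
firstPair∉shift true (_ ∷ K) = (λ ()) ∷ firstPair∉shift true K
firstPair∉shift false (_ ∷ K) = (λ ()) ∷ firstPair∉shift false K

sweep-singles-unique : ∀ n (odd : Fin n → Bool) shift toggle → Unique (singles (sweep n odd shift toggle))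
sweep-singles-unique zero odd shift toggle = []
sweep-singles-unique (suc zero) odd shift toggle with odd zero
... | true = [] ∷ []
... | false = []
sweep-singles-unique (suc (suc n)) odd shift toggle with odd zero xor odd (suc zero)
... | true = firstPair∉shift _ _ ∷ unique-shift (sweep-singles-unique n _ _ false)
... | false = unique-shift (sweep-singles-unique n _ _ false)

sweep-swaps-distinct : ∀ n (odd : Fin n → Bool) shift toggle →
  distinctPairs (swaps (sweep n odd shift toggle)) ≡ parity (swaps (sweep n odd shift toggle))
sweep-swaps-distinct zero odd shift toggle = refl
sweep-swaps-distinct (suc zero) odd shift toggle = refl
sweep-swaps-distinct (suc (suc n)) odd shift toggle =
  trans (⊕L-++ (swapIf swap) (map shiftPair S) _)
    (trans (cong₂ _xor_ (swapIf-distinct swap)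
                        (trans (⊕L-map shiftPair S _) (trans (sweep-swaps-distinct n _ _ false) (sym (parity-map shiftPair S)))))
           (sym (parity-++ (swapIf swap) (map shiftPair S))))
  where
  mixed = odd zero xor odd (suc zero)
  swap = ((odd zero ∧ odd (suc zero)) xor (shift ∧ mixed)) xor toggle
  S = swaps (sweep n (odd ∘ shift₂) (shift ∧ not mixed) false)
  swapIf-distinct : ∀ sw → distinctPairs (swapIf {n} sw) ≡ parity (swapIf {n} sw)
  swapIf-distinct true = refl
  swapIf-distinct false = refl

Ranks : ∀ {n} → (Fin n → ℕ) → List (Pair n) → Set
Ranks r S = ∀ u v → (u <ᵇ v) xor edges S u v ≡ true → r u < r v

edges-shift : ∀ {n} (S : List (Pair n)) u v → edges (map shiftPair S) (shift₂ u) (shift₂ v) ≡ edges S u v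
edges-shift S u v = ⊕L-map shiftPair S _

edges-shift-firstPair : ∀ {n} (S : List (Pair n)) u v → inFirstPair v ≡ true → edges (map shiftPair S) u v ≡ false
edges-shift-firstPair S u zero _ =
  trans (⊕L-map shiftPair S _) (⊕L-false S (λ { (a , b) → cong₂ _xor_ (∧-zeroʳ (u ≡ᵇ shift₂ a)) (∧-zeroʳ (u ≡ᵇ shift₂ b)) }))
edges-shift-firstPair S u (suc zero) _ =
  trans (⊕L-map shiftPair S _) (⊕L-false S (λ { (a , b) → cong₂ _xor_ (∧-zeroʳ (u ≡ᵇ shift₂ a)) (∧-zeroʳ (u ≡ᵇ shift₂ b)) }))

ranks-firstPair : ∀ {n} sw (r : Fin n → ℕ) u v → inFirstPair v ≡ true →
  (u <ᵇ v) xor (edges (swapIf {n} sw) u v xor false) ≡ true → rankAfter sw r u < rankAfter sw r v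
ranks-firstPair true r (suc zero) zero _ _ = s≤s z≤n
ranks-firstPair false r zero (suc zero) _ _ = s≤s z≤n
ranks-firstPair true r zero zero _ ()
ranks-firstPair true r zero (suc zero) _ ()
ranks-firstPair true r (suc zero) (suc zero) _ ()
ranks-firstPair true r (suc (suc u)) zero _ ()
ranks-firstPair true r (suc (suc u)) (suc zero) _ ()
ranks-firstPair false r zero zero _ ()
ranks-firstPair false r (suc zero) zero _ ()
ranks-firstPair false r (suc zero) (suc zero) _ ()
ranks-firstPair false r (suc (suc u)) zero _ ()
ranks-firstPair false r (suc (suc u)) (suc zero) _ ()

rankAfter-firstPair : ∀ {n} sw (r : Fin n → ℕ) u → inFirstPair u ≡ true → rankAfter sw r u ≤ 1
rankAfter-firstPair true r zero _ = s≤s z≤n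
rankAfter-firstPair false r zero _ = z≤n
rankAfter-firstPair true r (suc zero) _ = z≤n
rankAfter-firstPair false r (suc zero) _ = s≤s z≤n

edges-step-firstPair : ∀ {n} sw (S : List (Pair n)) u v → inFirstPair v ≡ true →
  edges (swapIf sw ++ map shiftPair S) u v ≡ edges (swapIf sw) u v xor false
edges-step-firstPair sw S u v v-first =
  trans (edges-++ (swapIf sw) (map shiftPair S) u v) (cong (edges (swapIf sw) u v xor_) (edges-shift-firstPair S u v v-first))

ranks-step : ∀ {n} sw (S : List (Pair n)) r → Ranks r S → Ranks (rankAfter sw r) (swapIf sw ++ map shiftPair S)
ranks-step sw S r ranked (suc (suc u)) (suc (suc v)) h =
  s≤s (s≤s (ranked u v (trans (cong ((u <ᵇ v) xor_) (sym inner)) h)))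
  where
  inner : edges (swapIf sw ++ map shiftPair S) (shift₂ u) (shift₂ v) ≡ edges S u v
  inner = trans (edges-++ (swapIf sw) (map shiftPair S) (shift₂ u) (shift₂ v))
                (cong₂ _xor_ (swapIf-inner sw) (edges-shift S u v))
    where
    swapIf-inner : ∀ sw → edges (swapIf sw) (shift₂ u) (shift₂ v) ≡ false
    swapIf-inner true = refl
    swapIf-inner false = refl
ranks-step sw S r ranked zero (suc (suc v)) h = s≤s (ℕ.≤-trans (rankAfter-firstPair sw r zero refl) (s≤s z≤n))
ranks-step sw S r ranked (suc zero) (suc (suc v)) h = s≤s (ℕ.≤-trans (rankAfter-firstPair sw r (suc zero) refl) (s≤s z≤n))
ranks-step sw S r ranked u zero h =
  ranks-firstPair sw r u zero refl (trans (cong ((u <ᵇ zero) xor_) (sym (edges-step-firstPair sw S u zero refl))) h)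
ranks-step sw S r ranked u (suc zero) h =
  ranks-firstPair sw r u (suc zero) refl (trans (cong ((u <ᵇ suc zero) xor_) (sym (edges-step-firstPair sw S u (suc zero) refl))) h)

sweep-ranks : ∀ n (odd : Fin n → Bool) shift toggle →
  Ranks (rank (sweep n odd shift toggle)) (swaps (sweep n odd shift toggle))
sweep-ranks zero odd shift toggle () v h
sweep-ranks (suc zero) odd shift toggle zero zero ()
sweep-ranks (suc (suc n)) odd shift toggle = ranks-step _ _ _ (sweep-ranks n _ _ false)

parity-step : ∀ {n} sw (S₁ S₀ : List (Pair n)) u → parity S₁ ≡ parity S₀ xor u →
  parity (swapIf sw ++ map shiftPair S₁) ≡ parity (swapIf sw ++ map shiftPair S₀) xor u
parity-step sw S₁ S₀ u h = begin
  parity (swapIf sw ++ map shiftPair S₁)          ≡⟨ parity-++ (swapIf sw) _ ⟩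
  parity (swapIf sw) xor parity (map shiftPair S₁) ≡⟨ cong (parity (swapIf sw) xor_) (trans (parity-map shiftPair S₁) h) ⟩
  parity (swapIf sw) xor (parity S₀ xor u)         ≡⟨ sym (xor-assoc (parity (swapIf sw)) (parity S₀) u) ⟩
  (parity (swapIf sw) xor parity S₀) xor u         ≡⟨ cong (_xor u) (cong (parity (swapIf sw) xor_) (sym (parity-map shiftPair S₀))) ⟩
  (parity (swapIf sw) xor parity (map shiftPair S₀)) xor u ≡⟨ cong (_xor u) (sym (parity-++ (swapIf sw) _)) ⟩
  parity (swapIf sw ++ map shiftPair S₀) xor u ∎
  where open ≡-Reasoning

ShiftEffect : ∀ n → (Fin n → Bool) → Set
ShiftEffect n odd =
  length (singles (sweep n odd true false)) ≡ length (singles (sweep n odd false false)) ×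
  parity (swaps (sweep n odd true false)) ≡ parity (swaps (sweep n odd false false)) xor shifted (sweep n odd true false) ×
  (shifted (sweep n odd true false) ≡ false → length (singles (sweep n odd false false)) ≤ 1)

shift-unmixed : ∀ {n} sw (S₁ S₀ : List (Pair n)) (K₁ K₀ : List (Fin n)) u →
  length K₁ ≡ length K₀ × parity S₁ ≡ parity S₀ xor u × (u ≡ false → length K₀ ≤ 1) →
  length (map shift₂ K₁) ≡ length (map shift₂ K₀) ×
  parity (swapIf sw ++ map shiftPair S₁) ≡ parity (swapIf sw ++ map shiftPair S₀) xor u ×
  (u ≡ false → length (map shift₂ K₀) ≤ 1)
shift-unmixed sw S₁ S₀ K₁ K₀ u (same-length , parity-shift , unshifted-short) =
  trans (length-map shift₂ K₁) (trans same-length (sym (length-map shift₂ K₀))) ,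
  parity-step sw S₁ S₀ u parity-shift ,
  λ h → ℕ.≤-trans (ℕ.≤-reflexive (length-map shift₂ K₀)) (unshifted-short h)

sweep-shift : ∀ n (odd : Fin n → Bool) → ShiftEffect n odd
sweep-shift zero odd = refl , refl , λ _ → z≤n
sweep-shift (suc zero) odd with odd zero
... | true = refl , refl , λ _ → s≤s z≤n
... | false = refl , refl , λ _ → z≤n
sweep-shift (suc (suc n)) odd with odd zero | odd (suc zero) | sweep-shift n (odd ∘ shift₂)
... | true | true | effect = shift-unmixed true (swaps rest₁) (swaps rest₀) (singles rest₁) (singles rest₀) (shifted rest₁) effect
  where
  rest₁ = sweep n (odd ∘ shift₂) true false
  rest₀ = sweep n (odd ∘ shift₂) false false
... | false | false | effect = shift-unmixed false (swaps rest₁) (swaps rest₀) (singles rest₁) (singles rest₀) (shifted rest₁) effect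
  where
  rest₁ = sweep n (odd ∘ shift₂) true false
  rest₀ = sweep n (odd ∘ shift₂) false false
... | true | false | _ = refl , xor-comm true _ , λ ()
... | false | true | _ = refl , xor-comm true _ , λ ()

sweep-toggle-parity : ∀ n (odd : Fin (2 + n) → Bool) shift →
  parity (swaps (sweep (2 + n) odd shift true)) ≡ not (parity (swaps (sweep (2 + n) odd shift false)))
sweep-toggle-parity n odd shift = toggled ((odd zero ∧ odd (suc zero)) xor (shift ∧ (odd zero xor odd (suc zero)))) _
  where
  toggled : ∀ x (S : List (Pair (2 + n))) → parity (swapIf {n} (x xor true) ++ S) ≡ not (parity (swapIf {n} (x xor false) ++ S))
  toggled true S = sym (not-involutive _)
  toggled false S = refl

pairUp : ∀ {A : Set} → List A → List (A × A)
pairUp [] = []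
pairUp (x ∷ []) = []
pairUp (x ∷ y ∷ xs) = (x , y) ∷ pairUp xs

pairUp-length : ∀ {A : Set} (xs : List A) → 2 * length (pairUp xs) ≤ length xs
pairUp-length [] = z≤n
pairUp-length (x ∷ []) = z≤n
pairUp-length (x ∷ y ∷ xs) =
  ℕ.≤-trans (ℕ.≤-reflexive (ℕ.*-suc 2 (length (pairUp xs)))) (s≤s (s≤s (pairUp-length xs)))

pairUp-incidence : ∀ {n} (v : Fin n) (K : List (Fin n)) → parity K ≡ false → incidence v (pairUp K) ≡ occurrence v K
pairUp-incidence v [] _ = refl
pairUp-incidence v (x ∷ []) ()
pairUp-incidence v (x ∷ y ∷ K) even =
  trans (cong (((v ≡ᵇ x) xor (v ≡ᵇ y)) xor_) (pairUp-incidence v K (trans (sym (not-involutive _)) even)))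
        (xor-assoc (v ≡ᵇ x) (v ≡ᵇ y) _)

pairUp-distinct : ∀ {n} (K : List (Fin n)) → Unique K → distinctPairs (pairUp K) ≡ parity (pairUp K)
pairUp-distinct [] _ = refl
pairUp-distinct (x ∷ []) _ = refl
pairUp-distinct (x ∷ y ∷ K) ((x≢y ∷ _) ∷ (_ ∷ K-unique)) = cong₂ _xor_ (cong not (≢⇒≡ᵇ-false x≢y)) (pairUp-distinct K K-unique)

pairUp-parity : ∀ {A B : Set} (xs : List A) (ys : List B) → length xs ≡ length ys → parity (pairUp xs) ≡ parity (pairUp ys)
pairUp-parity [] [] _ = refl
pairUp-parity (x ∷ []) (y ∷ []) _ = refl
pairUp-parity (x ∷ x′ ∷ xs) (y ∷ y′ ∷ ys) h = cong not (pairUp-parity xs ys (ℕ.suc-injective (ℕ.suc-injective h)))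

⊕Σ-incidence : ∀ {n} (S : List (Pair n)) → ⊕Σ (λ v → incidence v S) ≡ false
⊕Σ-incidence S = trans (⊕Σ-⊕L S (λ { (a , b) v → (v ≡ᵇ a) xor (v ≡ᵇ b) }))
  (⊕L-false S (λ { (a , b) → trans (⊕Σ-xor (_≡ᵇ a) (_≡ᵇ b)) (cong₂ _xor_ (⊕Σ-≡ᵇ a) (⊕Σ-≡ᵇ b)) }))

⊕Σ-occurrence : ∀ {n} (K : List (Fin n)) → ⊕Σ (λ v → occurrence v K) ≡ parity K
⊕Σ-occurrence K = trans (⊕Σ-⊕L K (λ k v → v ≡ᵇ k)) (⊕L-cong K ⊕Σ-≡ᵇ)

sweep-singles-even : ∀ n (odd : Fin n → Bool) shift → ⊕Σ odd ≡ false → parity (singles (sweep n odd shift false)) ≡ false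
sweep-singles-even n odd shift even = begin
  parity K                                                  ≡⟨ sym (⊕Σ-occurrence K) ⟩
  ⊕Σ (λ v → occurrence v K)                                 ≡⟨ cong (_xor ⊕Σ (λ v → occurrence v K)) (sym (⊕Σ-incidence S)) ⟩
  ⊕Σ (λ v → incidence v S) xor ⊕Σ (λ v → occurrence v K)   ≡⟨ sym (⊕Σ-xor (λ v → incidence v S) (λ v → occurrence v K)) ⟩
  ⊕Σ (λ v → incidence v S xor occurrence v K)               ≡⟨ ⊕Σ-cong (sweep-incidence n odd shift) ⟩
  ⊕Σ odd                                                    ≡⟨ even ⟩
  false ∎
  where
  open ≡-Reasoning
  S = swaps (sweep n odd shift false)
  K = singles (sweep n odd shift false)

short-even⇒[] : ∀ {A : Set} (xs : List A) → length xs ≤ 1 → parity xs ≡ false → xs ≡ []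
short-even⇒[] [] _ _ = refl
short-even⇒[] (x ∷ []) _ ()
short-even⇒[] (x ∷ y ∷ xs) (s≤s ()) _

complete : ∀ {n} → Digraph n → Digraph n
complete D u v = D u v ∨ (not (D v u) ∧ (u <ᵇ v))

complete-⊇ : ∀ {n} (D : Digraph n) {u v} → D u v ≡ true → complete D u v ≡ true
complete-⊇ D h rewrite h = refl

complete-tournament : ∀ {n} {D : Digraph n} → IsOriented D → ∀ {u v} → u ≢ v → complete D v u ≡ not (complete D u v)
complete-tournament {D = D} (_ , no-digon) {u} {v} u≢v with D u v in uv | D v u in vu
... | true | false = refl
... | false | true = refl
... | false | false = <ᵇ-asym u v u≢v
... | true | true with trans (sym (no-digon u v uv)) vu
...   | ()

complete-irrefl : ∀ {n} {D : Digraph n} → IsOriented D → ∀ u → complete D u u ≡ false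
complete-irrefl {D = D} (loopless , _) u rewrite loopless u = <ᵇ-irrefl u

walk-rank : ∀ {n} {R : Fin n → Fin n → Set} (r : Fin n → ℕ) → (∀ u v → R u v → r u < r v) →
  ∀ {u v} → Walk R u v → r u < r v
walk-rank r increasing (step uv) = increasing _ _ uv
walk-rank r increasing (uv ∷w walk) = ℕ.<-trans (increasing _ _ uv) (walk-rank r increasing walk)

edge-true : ∀ {n} (a b u v : Fin n) → edge a b u v ≡ true → (u , v) ≡ (a , b) ⊎ (u , v) ≡ (b , a)
edge-true a b u v h with (u ≡ᵇ a) ∧ (v ≡ᵇ b) in forward
... | true = inj₁ (cong₂ _,_ (≡ᵇ⇒≡ (∧-conicalˡ _ _ forward)) (≡ᵇ⇒≡ (∧-conicalʳ _ _ forward)))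
... | false = inj₂ (cong₂ _,_ (≡ᵇ⇒≡ (∧-conicalˡ _ _ h)) (≡ᵇ⇒≡ (∧-conicalʳ _ _ h)))

edges-true⇒∈ : ∀ {n} (L : List (Pair n)) u v → edges L u v ≡ true → (u , v) ∈ L ⊎ (v , u) ∈ L
edges-true⇒∈ [] u v ()
edges-true⇒∈ ((a , b) ∷ L) u v h with edge a b u v in e
... | false = Sum.map there there (edges-true⇒∈ L u v h)
... | true = Sum.map here (here ∘ swap-≡) (edge-true a b u v e)
  where
  swap-≡ : (u , v) ≡ (b , a) → (v , u) ≡ (a , b)
  swap-≡ refl = refl

-- D is inverted into a subgraph of the tournament obtained from the transitive one by reversing
-- the pairs S ++ L; reversing S alone keeps it acyclic, so the arcs of D′ on pairs of L form a
-- feedback arc set.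
module FeedbackArcSet {n} (D : Digraph n) (D-oriented : IsOriented D) (S L : List (Pair n))
  (r : Fin n → ℕ) (ranked : Ranks r S) (Xs : List (Subset n))
  (realises : ∀ u v → u ≢ v → flipPattern Xs u v ≡ complete D u v xor ((u <ᵇ v) xor edges (S ++ L) u v)) where

  target : Relation n
  target u v = (u <ᵇ v) xor edges (S ++ L) u v

  D′ : Digraph n
  D′ = invertAll D Xs

  D′-irrefl : ∀ u → D′ u u ≡ false
  D′-irrefl u = trans (invertAll-flipPattern D Xs u u) (loop (flipPattern Xs u u))
    where
    loop : ∀ b → (if b then D u u else D u u) ≡ false
    loop true = proj₁ D-oriented u
    loop false = proj₁ D-oriented u

  D′-arc⇒≢ : ∀ {u v} → D′ u v ≡ true → u ≢ v
  D′-arc⇒≢ {u} h refl with trans (sym h) (D′-irrefl u)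
  ... | ()

  D′⊆target : ∀ u v → D′ u v ≡ true → target u v ≡ true
  D′⊆target u v h = inverted (flipPattern Xs u v) refl (trans (sym (invertAll-flipPattern D Xs u v)) h)
    where
    u≢v = D′-arc⇒≢ h
    agree : complete D u v xor target u v ≡ flipPattern Xs u v
    agree = sym (realises u v u≢v)
    inverted : ∀ b → flipPattern Xs u v ≡ b → (if b then D v u else D u v) ≡ true → target u v ≡ true
    inverted true flipped vu =
      trans (cong (_xor target u v) (sym backward)) (trans agree flipped)
      where
      backward : complete D u v ≡ false
      backward = trans (complete-tournament D-oriented (u≢v ∘ sym)) (cong not (complete-⊇ D vu))
    inverted false kept uv = kept-arc (trans agree kept) (complete-⊇ D uv)
      where
      kept-arc : ∀ {a b} → a xor b ≡ false → a ≡ true → b ≡ true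
      kept-arc {true} {true} _ _ = refl

  target-tournament : ∀ {u v} → u ≢ v → target v u ≡ not (target u v)
  target-tournament {u} {v} u≢v =
    trans (cong₂ _xor_ (<ᵇ-asym u v u≢v) (edges-sym (S ++ L) v u)) (sym (not-distribˡ-xor (u <ᵇ v) _))

  orient : Pair n → Pair n
  orient (a , b) = if D′ a b then (a , b) else (b , a)

  arc? : (e : Pair n) → Dec (Arc D′ (proj₁ e) (proj₂ e))
  arc? (a , b) = D′ a b Bool.≟ true

  _≟ᴾ_ : DecidableEquality (Pair n)
  _≟ᴾ_ = ×.≡-dec Fin._≟_ Fin._≟_

  F : List (Pair n)
  F = deduplicate _≟ᴾ_ (filter arc? (map orient L))

  F-unique : Unique F
  F-unique = UniqueDec.deduplicate-! _≟ᴾ_ (filter arc? (map orient L))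

  F-arcs : All (λ e → Arc D′ (proj₁ e) (proj₂ e)) F
  F-arcs = All.tabulate λ e∈F →
    proj₂ (∈-filter⁻ arc? {xs = map orient L} (∈-deduplicate⁻ _≟ᴾ_ (filter arc? (map orient L)) e∈F))

  F-length : length F ≤ length L
  F-length = ℕ.≤-trans (length-deduplicate _≟ᴾ_ (filter arc? (map orient L)))
                       (ℕ.≤-trans (length-filter arc? (map orient L)) (ℕ.≤-reflexive (length-map orient L)))

  arc-on-L⇒∈F : ∀ u v → D′ u v ≡ true → edges L u v ≡ true → (u , v) ∈ F
  arc-on-L⇒∈F u v uv on-L = ∈-deduplicate⁺ _≟ᴾ_ (∈-filter⁺ arc? (oriented (edges-true⇒∈ L u v on-L)) uv)
    where
    vu : D′ v u ≡ false
    vu with D′ v u in e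
    ... | false = refl
    ... | true with trans (sym (D′⊆target v u e))
                          (trans (target-tournament (D′-arc⇒≢ uv)) (cong not (D′⊆target u v uv)))
    ...   | ()
    oriented : (u , v) ∈ L ⊎ (v , u) ∈ L → (u , v) ∈ map orient L
    oriented (inj₁ uv∈L) = subst (_∈ map orient L) (cong (λ b → if b then (u , v) else (v , u)) uv) (∈-map⁺ orient uv∈L)
    oriented (inj₂ vu∈L) = subst (_∈ map orient L) (cong (λ b → if b then (v , u) else (u , v)) vu) (∈-map⁺ orient vu∈L)

  remaining-ranked : ∀ u v → deleteArcs D′ F u v → r u < r v
  remaining-ranked u v (uv , ∉F) with edges L u v in on-L
  ... | true = ⊥-elim (∉F (arc-on-L⇒∈F u v uv on-L))
  ... | false = ranked u v (begin
    (u <ᵇ v) xor edges S u v            ≡⟨ cong ((u <ᵇ v) xor_) (sym (xor-identityʳ (edges S u v))) ⟩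
    (u <ᵇ v) xor (edges S u v xor false) ≡⟨ cong (λ e → (u <ᵇ v) xor (edges S u v xor e)) (sym on-L) ⟩
    (u <ᵇ v) xor (edges S u v xor edges L u v) ≡⟨ cong ((u <ᵇ v) xor_) (sym (edges-++ S L u v)) ⟩
    target u v                          ≡⟨ D′⊆target u v uv ⟩
    true ∎)
    where open ≡-Reasoning

  fas : ∀ c → 2 * length L ≤ c → FasAtMostHalfOf D′ c
  fas c bound = F , (F-unique , F-arcs , λ u cycle → ℕ.<-irrefl refl (walk-rank r remaining-ranked cycle)) ,
                ℕ.≤-trans (ℕ.*-monoʳ-≤ 2 F-length) bound

triangle : ∀ {k} → List (Pair (3 + k))
triangle = (zero , suc zero) ∷ (suc zero , suc (suc zero)) ∷ (suc (suc zero) , zero) ∷ []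

inFirstThree : ∀ {k} → Fin (3 + k) → Bool
inFirstThree (suc (suc (suc _))) = false
inFirstThree _ = true

realisable-triangle : ∀ k → Realisable 3 (edges (triangle {k}))
realisable-triangle k = tabulate inFirstThree ∷ [] , size ∷ [] , λ s t s≢t →
  trans (cong (λ x → x xor false) (cong₂ _∧_ (lookup∘tabulate inFirstThree s) (lookup∘tabulate inFirstThree t)))
        (inTriangle s t s≢t)
  where
  size : ∣ tabulate (inFirstThree {k}) ∣ ≡ 3
  size = trans (∣tabulate∣≡count (inFirstThree {k})) (cong (3 +_) (count-false k))
  inTriangle : ∀ s t → s ≢ t → (inFirstThree s ∧ inFirstThree t) xor false ≡ edges triangle s t
  inTriangle zero zero s≢t = ⊥-elim (s≢t refl)
  inTriangle zero (suc zero) _ = refl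
  inTriangle zero (suc (suc zero)) _ = refl
  inTriangle zero (suc (suc (suc _))) _ = refl
  inTriangle (suc zero) zero _ = refl
  inTriangle (suc zero) (suc zero) s≢t = ⊥-elim (s≢t refl)
  inTriangle (suc zero) (suc (suc zero)) _ = refl
  inTriangle (suc zero) (suc (suc (suc _))) _ = refl
  inTriangle (suc (suc zero)) zero _ = refl
  inTriangle (suc (suc zero)) (suc zero) _ = refl
  inTriangle (suc (suc zero)) (suc (suc zero)) s≢t = ⊥-elim (s≢t refl)
  inTriangle (suc (suc zero)) (suc (suc (suc _))) _ = refl
  inTriangle (suc (suc (suc _))) t _ = refl

half≥4 : ∀ {k} → 4 ≤ k → 2 * 2 ≤ ⌈ 3 + k /2⌉
half≥4 (s≤s (s≤s (s≤s (s≤s _)))) = s≤s (s≤s (s≤s (s≤s z≤n)))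

module Construction (k q : ℕ) (q+4≤n : q + 4 ≤ 3 + k) (D : Digraph (3 + k)) (D-oriented : IsOriented D) where

  disagreement : Relation (3 + k)
  disagreement u v = complete D u v xor (u <ᵇ v)

  disagreement-sym : ∀ u v → disagreement u v ≡ disagreement v u
  disagreement-sym u v with u Fin.≟ v
  ... | yes refl = refl
  ... | no u≢v = sym (trans (cong₂ _xor_ (complete-tournament D-oriented u≢v) (<ᵇ-asym u v u≢v))
                            (xor-annihilates-not (complete D u v) (u <ᵇ v)))

  disagreement-irrefl : ∀ u → disagreement u u ≡ false
  disagreement-irrefl u = cong₂ _xor_ (complete-irrefl D-oriented u) (<ᵇ-irrefl u)

  odd : Fin (3 + k) → Bool
  odd = deg disagreement

  odd-even : ⊕Σ odd ≡ false
  odd-even = handshake disagreement disagreement-sym disagreement-irrefl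

  record Correction : Set where
    field
      ordered feedback : List (Pair (3 + k))
      ranking : Fin (3 + k) → ℕ
      ranks : Ranks ranking ordered
      balances : ∀ v → incidence v (ordered ++ feedback) ≡ odd v
      feedback-bound : 2 * length feedback ≤ ⌈ 3 + k /2⌉

    target : Relation (3 + k)
    target u v = disagreement u v xor edges (ordered ++ feedback) u v

    target-eulerian : Eulerian target
    target-eulerian = record
      { symmetric = λ s t → cong₂ _xor_ (disagreement-sym s t) (edges-sym (ordered ++ feedback) s t)
      ; irreflexive = λ s → cong₂ _xor_ (disagreement-irrefl s) (edges-irrefl (ordered ++ feedback) s)
      ; evenDegrees = λ v → trans (⊕Σ-xor (disagreement v) (edges (ordered ++ feedback) v))
          (trans (cong (odd v xor_) (trans (deg-edges (ordered ++ feedback) v) (balances v))) (xor-same (odd v)))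
      }

    target-size : ⊕Σ< target ≡ ⊕Σ< disagreement xor distinctPairs (ordered ++ feedback)
    target-size = trans (⊕Σ<-xor disagreement (edges (ordered ++ feedback)))
                        (cong (⊕Σ< disagreement xor_) (⊕Σ<-edges (ordered ++ feedback)))

  open Correction

  Solution : Set
  Solution = Σ (List (Subset (3 + k))) λ Xs → All (HasSize (2 + q)) Xs × FasAtMostHalfOf (invertAll D Xs) ⌈ 3 + k /2⌉

  solution : (C : Correction) → Realisable (2 + q) (target C) → Solution
  solution C (Xs , sizes , realises) = Xs , sizes ,
    FeedbackArcSet.fas D D-oriented (ordered C) (feedback C) (ranking C) (ranks C) Xs
      (λ u v u≢v → trans (realises u v u≢v) (xor-assoc (complete D u v) (u <ᵇ v) _))
      ⌈ 3 + k /2⌉ (feedback-bound C)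

  solve : (C : Correction) → ⊕Σ< (target C) ≡ false → Solution
  solve C even = solution C (SquareDecomposition.realisable k (target C) (target-eulerian C) even q q+4≤n)

  -- For p = 3 a single inversion of three vertices changes the parity of the number of edges.
  solveWithTriangle : q ≡ 1 → (C : Correction) → ⊕Σ< (target C) ≡ true → Solution
  solveWithTriangle refl C odd-size = solution C (realisable-cong cancel (realisable-xor withTriangle (realisable-triangle k)))
    where
    withTriangle : Realisable 3 (λ s t → target C s t xor edges (triangle {k}) s t)
    withTriangle = SquareDecomposition.realisable k _
      (eulerian-xor (target-eulerian C) (eulerian-edges (triangle {k}) triangle-even))
      (trans (⊕Σ<-xor (target C) (edges (triangle {k}))) (cong₂ _xor_ odd-size (⊕Σ<-edges (triangle {k})))) 1 q+4≤n
      where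
      triangle-even : ∀ v → incidence v (triangle {k}) ≡ false
      triangle-even v = byTruthTable 3
        (λ { (a ∷ b ∷ c ∷ []) → (a xor b) xor ((b xor c) xor ((c xor a) xor false)) }) (λ _ → false) refl
        ((v ≡ᵇ zero) ∷ (v ≡ᵇ suc zero) ∷ (v ≡ᵇ suc (suc zero)) ∷ [])
    cancel : ∀ s t → (target C s t xor edges (triangle {k}) s t) xor edges (triangle {k}) s t ≡ target C s t
    cancel s t = xor-cancelʳ _ _ _ refl

  sweepCorrection : Bool → Correction
  sweepCorrection shift = record
    { ordered = swaps R
    ; feedback = pairUp (singles R)
    ; ranking = rank R
    ; ranks = sweep-ranks (3 + k) odd shift false
    ; balances = λ v → trans (incidence-++ v (swaps R) (pairUp (singles R)))
        (trans (cong (incidence v (swaps R) xor_) (pairUp-incidence v (singles R) (sweep-singles-even (3 + k) odd shift odd-even)))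
               (sweep-incidence (3 + k) odd shift v))
    ; feedback-bound = ℕ.≤-trans (pairUp-length (singles R)) (sweep-singles-length (3 + k) odd shift false)
    }
    where R = sweep (3 + k) odd shift false

  sweepCorrection-distinct : ∀ shift → distinctPairs (ordered (sweepCorrection shift) ++ feedback (sweepCorrection shift))
    ≡ parity (swaps (sweep (3 + k) odd shift false)) xor parity (pairUp (singles (sweep (3 + k) odd shift false)))
  sweepCorrection-distinct shift = trans (⊕L-++ (swaps R) (pairUp (singles R)) _)
    (cong₂ _xor_ (sweep-swaps-distinct (3 + k) odd shift false) (pairUp-distinct (singles R) (sweep-singles-unique (3 + k) odd shift false)))
    where R = sweep (3 + k) odd shift false

  -- Swapping {0, 1} once more changes the parity; the pairs {0, 2} and {1, 2} restore the degrees.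
  toggledCorrection : singles (sweep (3 + k) odd false false) ≡ [] → 4 ≤ k → Correction
  toggledCorrection no-singles 4≤k = record
    { ordered = swaps R
    ; feedback = L₂
    ; ranking = rank R
    ; ranks = sweep-ranks (3 + k) odd false true
    ; balances = λ v → trans (incidence-++ v (swaps R) L₂) (trans (cong (incidence v (swaps R) xor_) (L₂-incidence v))
        (xor-cancelʳ (incidence v (swaps R)) (inFirstPair v) (odd v) (trans (sym (xor-identityʳ (incidence v (swaps R))))
          (trans (cong (incidence v (swaps R) xor_) (sym (cong (occurrence v) no-singles)))
                 (sweep-incidence-toggled (suc k) odd false true v)))))
    ; feedback-bound = half≥4 4≤k
    }
    where
    R = sweep (3 + k) odd false true
    L₂ : List (Pair (3 + k))
    L₂ = (zero , suc (suc zero)) ∷ (suc zero , suc (suc zero)) ∷ []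
    L₂-incidence : ∀ v → incidence v L₂ ≡ inFirstPair v
    L₂-incidence zero = refl
    L₂-incidence (suc zero) = refl
    L₂-incidence (suc (suc zero)) = refl
    L₂-incidence (suc (suc (suc _))) = refl


  sweepCorrection-size : ∀ shift → ⊕Σ< (target (sweepCorrection shift))
    ≡ ⊕Σ< disagreement xor (parity (swaps (sweep (3 + k) odd shift false)) xor parity (pairUp (singles (sweep (3 + k) odd shift false))))
  sweepCorrection-size shift = trans (target-size (sweepCorrection shift)) (cong (⊕Σ< disagreement xor_) (sweepCorrection-distinct shift))

  shifted-even : ⊕Σ< (target (sweepCorrection false)) ≡ true → shifted (sweep (3 + k) odd true false) ≡ true →
    ⊕Σ< (target (sweepCorrection true)) ≡ false
  shifted-even odd-size shifted-here = begin
    ⊕Σ< (target (sweepCorrection true))                      ≡⟨ sweepCorrection-size true ⟩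
    ⊕Σ< disagreement xor (parity (swaps R₁) xor parity (pairUp (singles R₁)))
      ≡⟨ cong (⊕Σ< disagreement xor_) (cong₂ _xor_ (trans parity-shift (cong (parity (swaps R₀) xor_) shifted-here))
                                                   (pairUp-parity (singles R₁) (singles R₀) same-length)) ⟩
    ⊕Σ< disagreement xor ((parity (swaps R₀) xor true) xor parity (pairUp (singles R₀)))
      ≡⟨ xor-flip-middle (⊕Σ< disagreement) (parity (swaps R₀)) _ ⟩
    not (⊕Σ< disagreement xor (parity (swaps R₀) xor parity (pairUp (singles R₀))))
      ≡⟨ cong not (trans (sym (sweepCorrection-size false)) odd-size) ⟩
    false ∎
    where
    open ≡-Reasoning
    R₀ = sweep (3 + k) odd false false
    R₁ = sweep (3 + k) odd true false
    same-length = proj₁ (sweep-shift (3 + k) odd)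
    parity-shift = proj₁ (proj₂ (sweep-shift (3 + k) odd))

  toggled-even : ⊕Σ< (target (sweepCorrection false)) ≡ true → (no-singles : singles (sweep (3 + k) odd false false) ≡ []) →
    (4≤k : 4 ≤ k) → ⊕Σ< (target (toggledCorrection no-singles 4≤k)) ≡ false
  toggled-even odd-size no-singles 4≤k = begin
    ⊕Σ< (target (toggledCorrection no-singles 4≤k))
      ≡⟨ trans (target-size (toggledCorrection no-singles 4≤k))
               (cong (⊕Σ< disagreement xor_) (⊕L-++ (swaps R₂) (feedback (toggledCorrection no-singles 4≤k)) _)) ⟩
    ⊕Σ< disagreement xor (distinctPairs (swaps R₂) xor false)
      ≡⟨ cong (λ x → ⊕Σ< disagreement xor (x xor false))
              (trans (sweep-swaps-distinct (3 + k) odd false true) (trans (sweep-toggle-parity (suc k) odd false) (xor-comm true _))) ⟩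
    ⊕Σ< disagreement xor ((parity (swaps R₀) xor true) xor false)
      ≡⟨ xor-flip-middle (⊕Σ< disagreement) (parity (swaps R₀)) false ⟩
    not (⊕Σ< disagreement xor (parity (swaps R₀) xor false))
      ≡⟨ cong (λ K → not (⊕Σ< disagreement xor (parity (swaps R₀) xor parity (pairUp K)))) (sym no-singles) ⟩
    not (⊕Σ< disagreement xor (parity (swaps R₀) xor parity (pairUp (singles R₀))))
      ≡⟨ cong not (trans (sym (sweepCorrection-size false)) odd-size) ⟩
    false ∎
    where
    open ≡-Reasoning
    R₀ = sweep (3 + k) odd false false
    R₂ = sweep (3 + k) odd false true

  no-singles : shifted (sweep (3 + k) odd true false) ≡ false → singles (sweep (3 + k) odd false false) ≡ []
  no-singles unshifted = short-even⇒[] _ (proj₂ (proj₂ (sweep-shift (3 + k) odd)) unshifted)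
                                       (sweep-singles-even (3 + k) odd false odd-even)

  result : q ≡ 1 ⊎ 4 ≤ k → Solution
  result small-or-large with ⊕Σ< (target (sweepCorrection false)) in size
  ... | false = solve (sweepCorrection false) size
  ... | true with small-or-large
  ...   | inj₁ q≡1 = solveWithTriangle q≡1 (sweepCorrection false) size
  ...   | inj₂ 4≤k with shifted (sweep (3 + k) odd true false) in shifted?
  ...     | true = solve (sweepCorrection true) (shifted-even size shifted?)
  ...     | false = solve (toggledCorrection (no-singles shifted?) 4≤k) (toggled-even size (no-singles shifted?) 4≤k)

data Shape : ℕ → ℕ → Set where
  shape : ∀ q k → q + 4 ≤ 3 + k → q ≡ 1 ⊎ 4 ≤ k → Shape (2 + q) (3 + k)

shape-of : ∀ p → p % 2 ≡ 1 → 3 ≤ p → ∀ n → p + 2 ≤ n → Shape p n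
shape-of 3 _ _ (suc (suc (suc k))) p+2≤n = shape 1 k p+2≤n (inj₁ refl)
shape-of (suc (suc (suc (suc (suc r))))) _ _ (suc (suc (suc k))) (s≤s (s≤s (s≤s r+4≤k))) =
  shape (3 + r) k (s≤s (s≤s (s≤s (ℕ.≤-trans (ℕ.≤-reflexive r+4≡2+r+2) r+4≤k))))
        (inj₂ (ℕ.≤-trans (s≤s (s≤s (ℕ.m≤n+m 2 r))) r+4≤k))
  where
  r+4≡2+r+2 : r + 4 ≡ 2 + (r + 2)
  r+4≡2+r+2 = trans (ℕ.+-suc r 3) (cong suc (ℕ.+-suc r 2))
shape-of 1 _ (s≤s ()) _ _
shape-of 4 () _ _ _
shape-of 3 _ _ 0 ()
shape-of 3 _ _ 1 (s≤s ())
shape-of 3 _ _ 2 (s≤s (s≤s ()))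
shape-of (suc (suc (suc (suc (suc r))))) _ _ 0 ()
shape-of (suc (suc (suc (suc (suc r))))) _ _ 1 (s≤s ())
shape-of (suc (suc (suc (suc (suc r))))) _ _ 2 (s≤s (s≤s ()))

proposition4p1 : (p : ℕ) → p % 2 ≡ 1 → 3 ≤ p →
    (n : ℕ) → p + 2 ≤ n → (D : Digraph n) → IsOriented D →
    Σ (List (Subset n)) λ Xs → All (HasSize p) Xs ×
      FasAtMostHalfOf (invertAll D Xs) ⌈ n /2⌉
proposition4p1 p p-odd 3≤p n p+2≤n D D-oriented with shape-of p p-odd 3≤p n p+2≤n
... | shape q k q+4≤n small-or-large = Construction.result k q q+4≤n D D-oriented small-or-large
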